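{- Let $M$ and $N$ be matroids with $T=E(M)\cap E(N)$ nonempty. If $\emptyset\neq P\subsetneq T$, then $B_T(M,N)/P = B_{T-P}(M/P,N/P)$.
   Context: For matroids $M,N$ with $T=E(M)\cap E(N)$ nonempty, the bonding $B_T(M,N)$ is defined as follows. Let $T=\{t_1,\ldots,t_k\}$, and fix sets $S=\{s_1,\ldots,s_k\}$ and $Q=\{q_1,\ldots,q_k\}$ disjoint from each other and from $E(M)\cup E(N)$. Form $N'$ from $N$ by relabeling each $t_i$ as $s_i$. Form $H$ from $M\oplus N'$ by, for each $i\in[k]$, adding $q_i$ freely to the flat $\mathrm{cl}_{M\oplus N'}(\{t_i,s_i\})$, i.e., taking the principal extension $L+_Xq$ with $X=\mathrm{cl}(\{t_i,s_i\})$, whose rank function is $r'(Y)=r_L(Y)$ and $r'(Y\cup q)=r_L(Y)$ if $X\subseteq \mathrm{cl}_L(Y)$, $r_L(Y)+1$ otherwise (the order of these extensions does not matter). Then $B_T(M,N)=H/Q\backslash S$, a matroid on $E(M)\cup E(N)$. -}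

module Defs where

open import Data.Bool using (Bool; true; false; _∧_; _∨_; not; if_then_else_)
open import Data.Nat using (ℕ; _+_; _∸_; _≤_; _≡ᵇ_)
open import Data.List using (List; []; _∷_; _++_; map; mapMaybe; filterᵇ; length; foldl)
open import Data.Bool.ListAction using (any; all)
open import Data.List.Relation.Unary.Unique.Propositional using (Unique)
open import Data.Maybe using (Maybe; just; nothing)
open import Data.Product using (_×_)
open import Data.Sum using (_⊎_; inj₁; inj₂)
import Data.Sum.Properties as SumP
open import Relation.Binary.Definitions using (DecidableEquality)
open import Relation.Binary.PropositionalEquality using (_≡_)
open import Relation.Nullary.Decidable using (isYes)

Subset : Set → Set
Subset A = A → Bool

_∪ˢ_ : {A : Set} → Subset A → Subset A → Subset A
(X ∪ˢ Y) a = X a ∨ Y a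

_∩ˢ_ : {A : Set} → Subset A → Subset A → Subset A
(X ∩ˢ Y) a = X a ∧ Y a

_⊆ˢ_ : {A : Set} → Subset A → Subset A → Set
X ⊆ˢ Y = ∀ a → X a ≡ true → Y a ≡ true

-- The rank is given on all subsets of A but only its
-- values on subsets of E are meaningful (see IsMatroid.ext and _≈ᴹ_).
record RawMatroid (A : Set) : Set where
  field
    elems : List A
    rank  : Subset A → ℕ
open RawMatroid public

module _ {A : Set} (_≟_ : DecidableEquality A) where

  single : A → Subset A
  single a b = isYes (b ≟ a)

  inE : RawMatroid A → Subset A
  inE M a = any (λ b → isYes (a ≟ b)) (elems M)

  card : RawMatroid A → Subset A → ℕ
  card M X = length (filterᵇ X (elems M))

  record IsMatroid (M : RawMatroid A) : Set where
    field
      unique : Unique (elems M)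
      ext    : ∀ X Y → (∀ a → inE M a ≡ true → X a ≡ Y a) → rank M X ≡ rank M Y
      R1     : ∀ X → X ⊆ˢ inE M → rank M X ≤ card M X
      R2     : ∀ X Y → X ⊆ˢ Y → Y ⊆ˢ inE M → rank M X ≤ rank M Y
      R3     : ∀ X Y → X ⊆ˢ inE M → Y ⊆ˢ inE M →
               rank M (X ∪ˢ Y) + rank M (X ∩ˢ Y) ≤ rank M X + rank M Y

  _≈ᴹ_ : RawMatroid A → RawMatroid A → Set
  M ≈ᴹ N = (∀ a → inE M a ≡ inE N a) × (∀ X → X ⊆ˢ inE M → rank M X ≡ rank N X)

  cl : RawMatroid A → Subset A → Subset A
  cl M Z a = inE M a ∧ (rank M (Z ∪ˢ single a) ≡ᵇ rank M Z)

  subsetᵇ : RawMatroid A → Subset A → Subset A → Bool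
  subsetᵇ M X Y = all (λ a → not (X a) ∨ Y a) (elems M)

  contract : RawMatroid A → Subset A → RawMatroid A
  contract M P = record
    { elems = filterᵇ (λ a → not (P a)) (elems M)
    ; rank  = λ X → rank M (X ∪ˢ P) ∸ rank M P }

  delete : RawMatroid A → Subset A → RawMatroid A
  delete M D = record
    { elems = filterᵇ (λ a → not (D a)) (elems M)
    ; rank  = rank M }

  -- direct sum (of matroids with disjoint ground sets in the same universe)
  _⊕ᴹ_ : RawMatroid A → RawMatroid A → RawMatroid A
  L₁ ⊕ᴹ L₂ = record
    { elems = elems L₁ ++ elems L₂
    ; rank  = λ Y → rank L₁ (Y ∩ˢ inE L₁) + rank L₂ (Y ∩ˢ inE L₂) }

  -- principal extension L +_X q  (q a new element, X ⊆ E(L))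
  principalExt : RawMatroid A → Subset A → A → RawMatroid A
  principalExt L X q = record
    { elems = elems L ++ (q ∷ [])
    ; rank  = λ Y →
        let Y' = λ a → Y a ∧ not (isYes (a ≟ q)) in
        if Y q
          then rank L Y' + (if subsetᵇ L X (cl L Y') then 0 else 1)
          else rank L Y }

-- Working universe W = U ⊎ (U ⊎ U):
--   inj₁ u          : the elements of E(M) ∪ E(N)   (t_i of T as in M)
--   inj₂ (inj₁ t)   : s_t  (relabelled copy of t ∈ T in N')
--   inj₂ (inj₂ t)   : q_t
module _ {U : Set} (_≟_ : DecidableEquality U) where

  W : Set
  W = U ⊎ (U ⊎ U)

  _≟W_ : DecidableEquality W
  _≟W_ = SumP.≡-dec _≟_ (SumP.≡-dec _≟_ _≟_)

  common : RawMatroid U → RawMatroid U → Subset U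
  common M N u = inE _≟_ M u ∧ inE _≟_ N u

  liftM : RawMatroid U → RawMatroid W
  liftM M = record
    { elems = map inj₁ (elems M)
    ; rank  = λ Y → rank M (λ u → Y (inj₁ u)) }

  relabelN : Subset U → RawMatroid U → RawMatroid W
  relabelN T N = record
    { elems = map (λ u → if T u then inj₂ (inj₁ u) else inj₁ u) (elems N)
    ; rank  = λ Y → rank N (λ u → if T u then Y (inj₂ (inj₁ u)) else Y (inj₁ u)) }

  Sset : Subset U → Subset W
  Sset T (inj₂ (inj₁ u)) = T u
  Sset T _ = false

  Qset : Subset U → Subset W
  Qset T (inj₂ (inj₂ u)) = T u
  Qset T _ = false

  pullback : RawMatroid W → RawMatroid U
  pullback L = record
    { elems = mapMaybe fromInj₁ (elems L)
    ; rank  = λ X → rank L (toW X) }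
    where
      fromInj₁ : W → Maybe U
      fromInj₁ (inj₁ u) = just u
      fromInj₁ (inj₂ _) = nothing
      toW : Subset U → Subset W
      toW X (inj₁ u) = X u
      toW X (inj₂ _) = false

  bond : RawMatroid U → RawMatroid U → RawMatroid U
  bond M N = pullback (delete _≟W_ (contract _≟W_ H Q) S)
    where
      T : Subset U
      T = common M N
      Tlist : List U
      Tlist = filterᵇ T (elems M)
      L₀ : RawMatroid W
      L₀ = _⊕ᴹ_ _≟W_ (liftM M) (relabelN T N)
      flat : U → Subset W
      flat t = cl _≟W_ L₀ (single _≟W_ (inj₁ t) ∪ˢ single _≟W_ (inj₂ (inj₁ t)))
      step : RawMatroid W → U → RawMatroid W
      step L t = principalExt _≟W_ L (flat t) (inj₂ (inj₂ t))
      H : RawMatroid W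
      H = foldl step L₀ Tlist
      Q : Subset W
      Q = Qset T
      S : Subset W
      S = Sset T

-- Contracting P in B_T(M,N) = H/Q∖S amounts to contracting, in H, the points
-- p ∈ P besides Q.  Build H by adding the points q_t one at a time, with the
-- points of P contracted from the start.  For p ∈ P, once p is contracted the
-- flat cl{p, s_p} lies in the closure of a set exactly when s_p does, so adding
-- q_p freely and then contracting it has the effect of contracting s_p.  For
-- t ∉ P, the contraction preserves closures of sets avoiding P, so the
-- principal extension at t commutes with it.  By induction over T, the
-- partially built extension, contracted, agrees away from P with the
-- construction for M/P and N/P, starting from (M ⊕ N')/(P ∪ s_P) = M/P ⊕ (N/P)'.
-- The invariant carried through is that of a rank function on all subsets of
-- the universe, which direct sums, contractions and principal extensions preserve.

module Submission where

open import Defs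
open import Algebra.Bundles using (CommutativeMonoid)
open import Data.Bool using (Bool; true; false; _∧_; _∨_; not; if_then_else_)
open import Data.Bool.Properties
  using (∧-comm; ∨-comm; ∨-assoc; ∧-zeroʳ; ∨-zeroʳ; ∧-identityʳ; ∨-identityʳ;
         ∧-distribˡ-∨; ∧-distribʳ-∨; ∨-distribʳ-∧; ∨-commutativeMonoid;
         ∨-idempotentCommutativeMonoid; ∧-idempotentCommutativeMonoid; T-≡)
open import Data.Bool.ListAction using (any; all)
open import Data.Empty using (⊥; ⊥-elim)
open import Data.List using (List; []; _∷_; _++_; map; filterᵇ; foldl; mapMaybe; length)
open import Data.List.Relation.Unary.All using (All; []; _∷_)
open import Data.List.Relation.Unary.AllPairs using ([]; _∷_)
open import Data.List.Relation.Unary.Unique.Propositional using (Unique)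
import Data.List.Relation.Unary.Unique.Propositional.Properties as Unique
open import Data.Maybe using (Maybe; just; nothing)
open import Data.Nat using (ℕ; suc; _+_; _∸_; _≤_; _≡ᵇ_; z≤n; s≤s)
open import Data.Nat.Properties hiding (_≟_)
open import Data.Product using (Σ; _×_; _,_)
open import Data.Sum using (_⊎_; inj₁; inj₂)
open import Function.Bundles using (module Equivalence)
open import Relation.Binary.Definitions using (DecidableEquality)
open import Relation.Binary.PropositionalEquality
open import Relation.Nullary using (¬_; Dec; yes; no)
open import Relation.Nullary.Decidable using (isYes)
open import Relation.Nullary.Decidable.Core using (T?)

open import Algebra.Properties.CommutativeSemigroup +-commutativeSemigroup
  using () renaming (interchange to +-interchange; xy∙z≈xz∙y to +-swapʳ)
open import Algebra.Properties.CommutativeSemigroup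
  (CommutativeMonoid.commutativeSemigroup ∨-commutativeMonoid)
  using () renaming (xy∙z≈xz∙y to ∨-swapʳ)
open import Algebra.Properties.IdempotentCommutativeMonoid ∨-idempotentCommutativeMonoid
  using () renaming (∙-distrʳ-∙ to ∨-distribʳ-∨)
open import Algebra.Properties.IdempotentCommutativeMonoid ∧-idempotentCommutativeMonoid
  using () renaming (∙-distrʳ-∙ to ∧-distribʳ-∧)

true≢false : ∀ {b} → b ≡ true → b ≡ false → ⊥
true≢false refl ()

≡-from-⇔ : ∀ {b c : Bool} → (b ≡ true → c ≡ true) → (c ≡ true → b ≡ true) → b ≡ c
≡-from-⇔ {true}  {true}  f g = refl
≡-from-⇔ {true}  {false} f g = sym (f refl)
≡-from-⇔ {false} {true}  f g = g refl
≡-from-⇔ {false} {false} f g = refl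

bool-cases : ∀ {ℓ} {C : Set ℓ} (b : Bool) → (b ≡ true → C) → (b ≡ false → C) → C
bool-cases true  f g = f refl
bool-cases false f g = g refl

∧-elimˡ : ∀ {b c} → b ∧ c ≡ true → b ≡ true
∧-elimˡ {true} _ = refl

∧-elimʳ : ∀ {b c} → b ∧ c ≡ true → c ≡ true
∧-elimʳ {true} e = e

∨-introˡ : ∀ {b} c → b ≡ true → b ∨ c ≡ true
∨-introˡ c refl = refl

∨-introʳ : ∀ b {c} → c ≡ true → b ∨ c ≡ true
∨-introʳ true  _ = refl
∨-introʳ false e = e

[x∨y]∧¬y≡x∧¬y : ∀ x y → (x ∨ y) ∧ not y ≡ x ∧ not y
[x∨y]∧¬y≡x∧¬y x true  = trans (∧-zeroʳ _) (sym (∧-zeroʳ x))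
[x∨y]∧¬y≡x∧¬y x false = trans (∧-identityʳ _) (trans (∨-identityʳ x) (sym (∧-identityʳ x)))

≡ᵇ-sound : ∀ m n → (m ≡ᵇ n) ≡ true → m ≡ n
≡ᵇ-sound m n e = ≡ᵇ⇒≡ m n (Equivalence.from T-≡ e)

≡ᵇ-complete : ∀ m n → m ≡ n → (m ≡ᵇ n) ≡ true
≡ᵇ-complete m n e = Equivalence.to T-≡ (≡⇒≡ᵇ m n e)

[m+n]∸[o+p]≡[m∸o]+[n∸p] : ∀ {m n o p} → o ≤ m → p ≤ n → (m + n) ∸ (o + p) ≡ (m ∸ o) + (n ∸ p)
[m+n]∸[o+p]≡[m∸o]+[n∸p] {m} {n} {o} {p} o≤m p≤n = begin
  (m + n) ∸ (o + p)
    ≡⟨ cong₂ (λ x y → (x + y) ∸ (o + p)) (m∸n+n≡m o≤m) (m∸n+n≡m p≤n) ⟨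
  ((m ∸ o) + o + ((n ∸ p) + p)) ∸ (o + p)
    ≡⟨ cong (_∸ (o + p)) (+-interchange (m ∸ o) o (n ∸ p) p) ⟩
  ((m ∸ o) + (n ∸ p) + (o + p)) ∸ (o + p)
    ≡⟨ m+n∸n≡m _ (o + p) ⟩
  (m ∸ o) + (n ∸ p)
    ∎
  where open ≡-Reasoning

[m∸o]∸[n∸o]≡m∸n : ∀ {m n o} → o ≤ n → (m ∸ o) ∸ (n ∸ o) ≡ m ∸ n
[m∸o]∸[n∸o]≡m∸n {m} {n} {o} o≤n = trans (∸-+-assoc m o (n ∸ o)) (cong (m ∸_) (m+[n∸m]≡n o≤n))

∸-≡ᵇ-cancelʳ : ∀ {m n o} → o ≤ m → o ≤ n → (m ∸ o ≡ᵇ n ∸ o) ≡ (m ≡ᵇ n)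
∸-≡ᵇ-cancelʳ {m} {n} {o} o≤m o≤n = ≡-from-⇔
  (λ e → ≡ᵇ-complete _ _ (∸-cancelʳ-≡ o≤m o≤n (≡ᵇ-sound _ _ e)))
  (λ e → ≡ᵇ-complete _ _ (cong (_∸ o) (≡ᵇ-sound _ _ e)))

module RankFunctions {A : Set} (_≟_ : DecidableEquality A) where

  E : RawMatroid A → Subset A
  E = inE _≟_

  ⁅_⁆ : A → Subset A
  ⁅_⁆ = single _≟_

  elemᵇ : List A → A → Bool
  elemᵇ xs a = any (λ b → isYes (a ≟ b)) xs

  ⁅⁆-self : ∀ a → ⁅ a ⁆ a ≡ true
  ⁅⁆-self a with a ≟ a
  ... | yes _ = refl
  ... | no a≢a = ⊥-elim (a≢a refl)

  ⁅⁆-sound : ∀ {a b} → ⁅ a ⁆ b ≡ true → b ≡ a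
  ⁅⁆-sound {a} {b} e with b ≟ a
  ... | yes b≡a = b≡a

  ⁅⁆-other : ∀ {a b} → ¬ b ≡ a → ⁅ a ⁆ b ≡ false
  ⁅⁆-other {a} {b} b≢a with b ≟ a
  ... | yes b≡a = ⊥-elim (b≢a b≡a)
  ... | no _ = refl

  any-++ : ∀ (p : A → Bool) xs ys → any p (xs ++ ys) ≡ any p xs ∨ any p ys
  any-++ p []       ys = refl
  any-++ p (x ∷ xs) ys = trans (cong (p x ∨_) (any-++ p xs ys)) (sym (∨-assoc (p x) _ _))

  elemᵇ-filter : ∀ f xs a → elemᵇ (filterᵇ f xs) a ≡ f a ∧ elemᵇ xs a
  elemᵇ-filter f []       a = sym (∧-zeroʳ (f a))
  elemᵇ-filter f (x ∷ xs) a with f x in fx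
  ... | true with a ≟ x
  ...   | yes refl rewrite fx = refl
  ...   | no _ = elemᵇ-filter f xs a
  elemᵇ-filter f (x ∷ xs) a | false with a ≟ x
  ...   | yes refl rewrite elemᵇ-filter f xs a | fx = refl
  ...   | no _ = elemᵇ-filter f xs a

  elemᵇ-∉ : ∀ a xs → All (λ b → ¬ a ≡ b) xs → elemᵇ xs a ≡ false
  elemᵇ-∉ a []       []         = refl
  elemᵇ-∉ a (x ∷ xs) (a≢x ∷ ps) with a ≟ x
  ... | yes a≡x = ⊥-elim (a≢x a≡x)
  ... | no _ = elemᵇ-∉ a xs ps

  ⊆-∪ˡ : ∀ (X Y : Subset A) → X ⊆ˢ (X ∪ˢ Y)
  ⊆-∪ˡ X Y a e = ∨-introˡ (Y a) e

  ⊆-∪ʳ : ∀ (X Y : Subset A) → Y ⊆ˢ (X ∪ˢ Y)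
  ⊆-∪ʳ X Y a e = ∨-introʳ (X a) e

  ∪-monoˡ-⊆ : ∀ {X Y} (Z : Subset A) → X ⊆ˢ Y → (X ∪ˢ Z) ⊆ˢ (Y ∪ˢ Z)
  ∪-monoˡ-⊆ {X} {Y} Z X⊆Y a h with X a in xa
  ... | true  rewrite X⊆Y a xa = refl
  ... | false = ∨-introʳ (Y a) h

  ∩-monoˡ-⊆ : ∀ {X Y} (Z : Subset A) → X ⊆ˢ Y → (X ∩ˢ Z) ⊆ˢ (Y ∩ˢ Z)
  ∩-monoˡ-⊆ {X} Z X⊆Y a h = cong₂ _∧_ (X⊆Y a (∧-elimˡ h)) (∧-elimʳ {X a} h)

  subsetᵇ-sound : ∀ L X Y → subsetᵇ _≟_ L X Y ≡ true →
                  ∀ a → E L a ≡ true → X a ≡ true → Y a ≡ true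
  subsetᵇ-sound L X Y = go (elems L)
    where
      go : ∀ xs → all (λ a → not (X a) ∨ Y a) xs ≡ true →
           ∀ a → elemᵇ xs a ≡ true → X a ≡ true → Y a ≡ true
      go (x ∷ xs) h a m xa with a ≟ x
      ... | yes refl with X a | Y a | h
      ...   | true | true | _ = refl
      go (x ∷ xs) h a m xa | no _ with not (X x) ∨ Y x
      ...   | true = go xs h a m xa

  subsetᵇ-complete : ∀ L X Y → (∀ a → E L a ≡ true → X a ≡ true → Y a ≡ true) →
                     subsetᵇ _≟_ L X Y ≡ true
  subsetᵇ-complete L X Y = go (elems L)
    where
      go : ∀ xs → (∀ a → elemᵇ xs a ≡ true → X a ≡ true → Y a ≡ true) →
           all (λ a → not (X a) ∨ Y a) xs ≡ true
      go []       h = refl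
      go (x ∷ xs) h with X x in xx
      ... | false = go xs (λ a m → h a (∨-introʳ _ m))
      ... | true rewrite h x (∨-introˡ _ (⁅⁆-self x)) xx = go xs (λ a m → h a (∨-introʳ _ m))

  subsetᵇ-cong : ∀ L X Y Y′ → (∀ a → Y a ≡ Y′ a) → subsetᵇ _≟_ L X Y ≡ subsetᵇ _≟_ L X Y′
  subsetᵇ-cong L X Y Y′ h = go (elems L)
    where
      go : ∀ xs → all (λ a → not (X a) ∨ Y a) xs ≡ all (λ a → not (X a) ∨ Y′ a) xs
      go []       = refl
      go (x ∷ xs) = cong₂ _∧_ (cong (not (X x) ∨_) (h x)) (go xs)

  -- Unlike IsMatroid, this is preserved by principal
  -- extension, contraction and direct sum without tracking ground sets.
  record IsRankFunction (L : RawMatroid A) : Set where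
    field
      rank-cong       : ∀ X Y → (∀ a → E L a ≡ true → X a ≡ Y a) → rank L X ≡ rank L Y
      rank-mono       : ∀ X Y → X ⊆ˢ Y → rank L X ≤ rank L Y
      rank-submodular : ∀ X Y → rank L (X ∪ˢ Y) + rank L (X ∩ˢ Y) ≤ rank L X + rank L Y
      rank-unit       : ∀ X a → rank L (X ∪ˢ ⁅ a ⁆) ≤ suc (rank L X)

  module Closure {L : RawMatroid A} (isRank : IsRankFunction L) where
    open IsRankFunction isRank

    private
      r : Subset A → ℕ
      r = rank L

    rank-≗ : ∀ {X Y} → (∀ a → X a ≡ Y a) → r X ≡ r Y
    rank-≗ h = rank-cong _ _ (λ a _ → h a)

    rank-∪-mono : ∀ X Y → r X ≤ r (Y ∪ˢ X)
    rank-∪-mono X Y = rank-mono _ _ (⊆-∪ʳ Y X)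

    spans-mono : ∀ {Z Z′} x → r (Z ∪ˢ ⁅ x ⁆) ≡ r Z → Z ⊆ˢ Z′ → r (Z′ ∪ˢ ⁅ x ⁆) ≡ r Z′
    spans-mono {Z} {Z′} x Zx≡Z Z⊆Z′ = ≤-antisym Z′x≤Z′ (rank-mono _ _ (⊆-∪ˡ Z′ ⁅ x ⁆))
      where
        open ≤-Reasoning
        Zx : Subset A
        Zx = Z ∪ˢ ⁅ x ⁆
        Zx∪Z′≗Z′x : ∀ a → (Zx ∪ˢ Z′) a ≡ (Z′ ∪ˢ ⁅ x ⁆) a
        Zx∪Z′≗Z′x a with Z a in za | Z′ a in z′a | ⁅ x ⁆ a
        ... | true  | true  | _     = refl
        ... | true  | false | _     = ⊥-elim (true≢false (Z⊆Z′ a za) z′a)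
        ... | false | true  | true  = refl
        ... | false | true  | false = refl
        ... | false | false | true  = refl
        ... | false | false | false = refl
        Z⊆Zx∩Z′ : Z ⊆ˢ (Zx ∩ˢ Z′)
        Z⊆Zx∩Z′ a za rewrite za | Z⊆Z′ a za = refl
        Z′x≤Z′ : r (Z′ ∪ˢ ⁅ x ⁆) ≤ r Z′
        Z′x≤Z′ = +-cancelʳ-≤ (r Z) _ _ (begin
          r (Z′ ∪ˢ ⁅ x ⁆) + r Z           ≤⟨ +-monoʳ-≤ _ (rank-mono _ _ Z⊆Zx∩Z′) ⟩
          r (Z′ ∪ˢ ⁅ x ⁆) + r (Zx ∩ˢ Z′)  ≡⟨ cong (_+ r (Zx ∩ˢ Z′)) (rank-≗ Zx∪Z′≗Z′x) ⟨
          r (Zx ∪ˢ Z′) + r (Zx ∩ˢ Z′)     ≤⟨ rank-submodular Zx Z′ ⟩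
          r Zx + r Z′                     ≡⟨ cong (_+ r Z′) Zx≡Z ⟩
          r Z + r Z′                      ≡⟨ +-comm (r Z) (r Z′) ⟩
          r Z′ + r Z                      ∎)

    ∈cl⇒∈E : ∀ {Z a} → cl _≟_ L Z a ≡ true → E L a ≡ true
    ∈cl⇒∈E = ∧-elimˡ

    ∈cl⇒spans : ∀ {Z a} → cl _≟_ L Z a ≡ true → r (Z ∪ˢ ⁅ a ⁆) ≡ r Z
    ∈cl⇒spans {Z} {a} e = ≡ᵇ-sound _ _ (∧-elimʳ {E L a} e)

    spans⇒∈cl : ∀ {Z a} → E L a ≡ true → r (Z ∪ˢ ⁅ a ⁆) ≡ r Z → cl _≟_ L Z a ≡ true
    spans⇒∈cl e₁ e₂ rewrite e₁ = ≡ᵇ-complete _ _ e₂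

    ∉cl⇒rank-suc : ∀ {Z a} → E L a ≡ true → cl _≟_ L Z a ≡ false → r (Z ∪ˢ ⁅ a ⁆) ≡ suc (r Z)
    ∉cl⇒rank-suc {Z} {a} e a∉cl = ≤-antisym (rank-unit Z a)
      (≤∧≢⇒< (rank-mono _ _ (⊆-∪ˡ Z ⁅ a ⁆)) (λ eq → true≢false (spans⇒∈cl e (sym eq)) a∉cl))

    cl-mono : ∀ {Z Z′} → Z ⊆ˢ Z′ → cl _≟_ L Z ⊆ˢ cl _≟_ L Z′
    cl-mono Z⊆Z′ a c = spans⇒∈cl (∈cl⇒∈E c) (spans-mono a (∈cl⇒spans c) Z⊆Z′)

    cl-⊇-of-≡rank : ∀ {Z Z′} → Z ⊆ˢ Z′ → r Z ≡ r Z′ → cl _≟_ L Z′ ⊆ˢ cl _≟_ L Z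
    cl-⊇-of-≡rank {Z} {Z′} Z⊆Z′ eq a c = spans⇒∈cl (∈cl⇒∈E c) (≤-antisym (begin
      r (Z ∪ˢ ⁅ a ⁆)   ≤⟨ rank-mono _ _ (∪-monoˡ-⊆ ⁅ a ⁆ Z⊆Z′) ⟩
      r (Z′ ∪ˢ ⁅ a ⁆)  ≡⟨ ∈cl⇒spans c ⟩
      r Z′             ≡⟨ eq ⟨
      r Z              ∎) (rank-mono _ _ (⊆-∪ˡ Z ⁅ a ⁆)))
      where open ≤-Reasoning

    ⊆cl : ∀ {Z a} → E L a ≡ true → Z a ≡ true → cl _≟_ L Z a ≡ true
    ⊆cl {Z} {a} e za = spans⇒∈cl e (rank-≗ Za≗Z)
      where
        Za≗Z : ∀ b → (Z b ∨ ⁅ a ⁆ b) ≡ Z b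
        Za≗Z b with b ≟ a
        ... | yes refl rewrite za = refl
        ... | no _ = ∨-identityʳ (Z b)

    cl-∩-modular : ∀ {P Q} → r (P ∪ˢ Q) + r (P ∩ˢ Q) ≡ r P + r Q →
                   ∀ a → cl _≟_ L P a ≡ true → cl _≟_ L Q a ≡ true → cl _≟_ L (P ∩ˢ Q) a ≡ true
    cl-∩-modular {P} {Q} modular a cp cq =
      spans⇒∈cl (∈cl⇒∈E cp) (≤-antisym PQa≤PQ (rank-mono _ _ (⊆-∪ˡ (P ∩ˢ Q) ⁅ a ⁆)))
      where
        open ≤-Reasoning
        Pa : Subset A
        Pa = P ∪ˢ ⁅ a ⁆
        Qa : Subset A
        Qa = Q ∪ˢ ⁅ a ⁆
        P∪Q⊆Pa∪Qa : (P ∪ˢ Q) ⊆ˢ (Pa ∪ˢ Qa)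
        P∪Q⊆Pa∪Qa b h with P b
        ... | true  = refl
        ... | false rewrite h = ∨-introʳ (⁅ a ⁆ b) refl
        Pa∩Qa≗PQa : ∀ b → (Pa ∩ˢ Qa) b ≡ ((P ∩ˢ Q) ∪ˢ ⁅ a ⁆) b
        Pa∩Qa≗PQa b = sym (∨-distribʳ-∧ (⁅ a ⁆ b) (P b) (Q b))
        PQa≤PQ : r ((P ∩ˢ Q) ∪ˢ ⁅ a ⁆) ≤ r (P ∩ˢ Q)
        PQa≤PQ = +-cancelˡ-≤ (r (P ∪ˢ Q)) _ _ (begin
          r (P ∪ˢ Q) + r ((P ∩ˢ Q) ∪ˢ ⁅ a ⁆)  ≤⟨ +-monoˡ-≤ _ (rank-mono _ _ P∪Q⊆Pa∪Qa) ⟩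
          r (Pa ∪ˢ Qa) + r ((P ∩ˢ Q) ∪ˢ ⁅ a ⁆) ≡⟨ cong (r (Pa ∪ˢ Qa) +_) (rank-≗ Pa∩Qa≗PQa) ⟨
          r (Pa ∪ˢ Qa) + r (Pa ∩ˢ Qa)          ≤⟨ rank-submodular Pa Qa ⟩
          r Pa + r Qa                          ≡⟨ cong₂ _+_ (∈cl⇒spans cp) (∈cl⇒spans cq) ⟩
          r P + r Q                            ≡⟨ modular ⟨
          r (P ∪ˢ Q) + r (P ∩ˢ Q)              ∎)

    cl-pair-⊆ : ∀ {Z a b} → cl _≟_ L Z a ≡ true → cl _≟_ L Z b ≡ true →
                cl _≟_ L (⁅ a ⁆ ∪ˢ ⁅ b ⁆) ⊆ˢ cl _≟_ L Z
    cl-pair-⊆ {Z} {a} {b} ca cb x cx =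
      spans⇒∈cl (∈cl⇒∈E cx) (≤-antisym Zx≤Z (rank-mono _ _ (⊆-∪ˡ Z ⁅ x ⁆)))
      where
        open ≤-Reasoning
        ab : Subset A
        ab = ⁅ a ⁆ ∪ˢ ⁅ b ⁆
        Zab≡Z : r (Z ∪ˢ ab) ≡ r Z
        Zab≡Z = begin-equality
          r (Z ∪ˢ ab)                 ≡⟨ rank-≗ (λ c → sym (∨-assoc (Z c) (⁅ a ⁆ c) (⁅ b ⁆ c))) ⟩
          r ((Z ∪ˢ ⁅ a ⁆) ∪ˢ ⁅ b ⁆)   ≡⟨ spans-mono b (∈cl⇒spans cb) (⊆-∪ˡ Z ⁅ a ⁆) ⟩
          r (Z ∪ˢ ⁅ a ⁆)              ≡⟨ ∈cl⇒spans ca ⟩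
          r Z                         ∎
        Zx≤Z : r (Z ∪ˢ ⁅ x ⁆) ≤ r Z
        Zx≤Z = begin
          r (Z ∪ˢ ⁅ x ⁆)          ≤⟨ rank-mono _ _ (∪-monoˡ-⊆ ⁅ x ⁆ (⊆-∪ˡ Z ab)) ⟩
          r ((Z ∪ˢ ab) ∪ˢ ⁅ x ⁆)  ≡⟨ spans-mono x (∈cl⇒spans cx) (⊆-∪ʳ Z ab) ⟩
          r (Z ∪ˢ ab)             ≡⟨ Zab≡Z ⟩
          r Z                     ∎

  module PrincipalExtension {L : RawMatroid A} (isRank : IsRankFunction L) (X : Subset A) (q : A) where
    open IsRankFunction isRank
    open Closure isRank

    private
      r : Subset A → ℕ
      r = rank L

    L₊ : RawMatroid A
    L₊ = principalExt _≟_ L X q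

    r₊ : Subset A → ℕ
    r₊ = rank L₊

    _∖q : Subset A → Subset A
    (Y ∖q) a = Y a ∧ not (isYes (a ≟ q))

    spansX : Subset A → Bool
    spansX Z = subsetᵇ _≟_ L X (cl _≟_ L Z)

    δ : Subset A → ℕ
    δ Z = if spansX Z then 0 else 1

    -- ρ Z is the rank of Z ∪ {q} in L₊ (for q ∉ Z).
    ρ : Subset A → ℕ
    ρ Z = r Z + δ Z

    rank₊-∈ : ∀ {Y} → Y q ≡ true → r₊ Y ≡ ρ (Y ∖q)
    rank₊-∈ {Y} e = cong (λ b → if b then ρ (Y ∖q) else r Y) e

    rank₊-∉ : ∀ {Y} → Y q ≡ false → r₊ Y ≡ r Y
    rank₊-∉ {Y} e = cong (λ b → if b then ρ (Y ∖q) else r Y) e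

    E₊ : ∀ a → E L₊ a ≡ E L a ∨ ⁅ q ⁆ a
    E₊ a = trans (any-++ _ (elems L) (q ∷ [])) (cong (E L a ∨_) (∨-identityʳ _))

    ∈E⇒∈E₊ : ∀ {a} → E L a ≡ true → E L₊ a ≡ true
    ∈E⇒∈E₊ {a} e = trans (E₊ a) (∨-introˡ _ e)

    q∈E₊ : E L₊ q ≡ true
    q∈E₊ = trans (E₊ q) (∨-introʳ (E L q) (⁅⁆-self q))

    ∖q-≗ : ∀ {Y} → Y q ≡ false → ∀ a → (Y ∖q) a ≡ Y a
    ∖q-≗ {Y} e a with a ≟ q
    ... | yes refl rewrite e = refl
    ... | no _ = ∧-identityʳ (Y a)

    ∖q-mono : ∀ {Y Y′} → Y ⊆ˢ Y′ → (Y ∖q) ⊆ˢ (Y′ ∖q)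
    ∖q-mono = ∩-monoˡ-⊆ (λ a → not (isYes (a ≟ q)))

    spansX-sound : ∀ {Z} → spansX Z ≡ true → ∀ a → E L a ≡ true → X a ≡ true → cl _≟_ L Z a ≡ true
    spansX-sound {Z} = subsetᵇ-sound L X (cl _≟_ L Z)

    spansX-intro : ∀ {Z} → (∀ a → E L a ≡ true → X a ≡ true → cl _≟_ L Z a ≡ true) → spansX Z ≡ true
    spansX-intro {Z} = subsetᵇ-complete L X (cl _≟_ L Z)

    spansX-mono : ∀ {Z Z′} → Z ⊆ˢ Z′ → spansX Z ≡ true → spansX Z′ ≡ true
    spansX-mono Z⊆Z′ h = spansX-intro (λ a ea xa → cl-mono Z⊆Z′ a (spansX-sound h a ea xa))

    spansX-of-≡rank : ∀ {Z Z′} → Z ⊆ˢ Z′ → r Z ≡ r Z′ → spansX Z′ ≡ true → spansX Z ≡ true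
    spansX-of-≡rank Z⊆Z′ eq h =
      spansX-intro (λ a ea xa → cl-⊇-of-≡rank Z⊆Z′ eq a (spansX-sound h a ea xa))

    spansX-∩-modular : ∀ {Z Y} → r (Z ∪ˢ Y) + r (Z ∩ˢ Y) ≡ r Z + r Y →
                       spansX Z ≡ true → spansX Y ≡ true → spansX (Z ∩ˢ Y) ≡ true
    spansX-∩-modular modular hz hy = spansX-intro (λ a ea xa →
      cl-∩-modular modular a (spansX-sound hz a ea xa) (spansX-sound hy a ea xa))

    spansX-cong : ∀ {Z Z′} → (∀ a → E L a ≡ true → Z a ≡ Z′ a) → spansX Z ≡ spansX Z′
    spansX-cong {Z} {Z′} h = subsetᵇ-cong L X (cl _≟_ L Z) (cl _≟_ L Z′) cl≗
      where
        cl≗ : ∀ a → cl _≟_ L Z a ≡ cl _≟_ L Z′ a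
        cl≗ a = cong₂ (λ u v → E L a ∧ (u ≡ᵇ v))
                  (rank-cong _ _ (λ b e → cong (_∨ ⁅ a ⁆ b) (h b e))) (rank-cong _ _ h)

    δ-spans : ∀ {Z} → spansX Z ≡ true → δ Z ≡ 0
    δ-spans e = cong (λ b → if b then 0 else 1) e

    δ-¬spans : ∀ {Z} → spansX Z ≡ false → δ Z ≡ 1
    δ-¬spans e = cong (λ b → if b then 0 else 1) e

    δ≤1 : ∀ Z → δ Z ≤ 1
    δ≤1 Z with spansX Z
    ... | true  = z≤n
    ... | false = ≤-refl

    δ-antimono : ∀ {Z Z′} → Z ⊆ˢ Z′ → δ Z′ ≤ δ Z
    δ-antimono {Z} {Z′} Z⊆Z′ with spansX Z in e
    ... | true rewrite δ-spans (spansX-mono Z⊆Z′ e) = z≤n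
    ... | false = δ≤1 Z′

    δ-cong : ∀ {Z Z′} → (∀ a → E L a ≡ true → Z a ≡ Z′ a) → δ Z ≡ δ Z′
    δ-cong h = cong (λ b → if b then 0 else 1) (spansX-cong h)

    ρ-cong : ∀ {Z Z′} → (∀ a → E L a ≡ true → Z a ≡ Z′ a) → ρ Z ≡ ρ Z′
    ρ-cong h = cong₂ _+_ (rank-cong _ _ h) (δ-cong h)

    ρ-≗ : ∀ {Z Z′} → (∀ a → Z a ≡ Z′ a) → ρ Z ≡ ρ Z′
    ρ-≗ h = ρ-cong (λ a _ → h a)

    δ-≡rank : ∀ {Z Z′} → Z ⊆ˢ Z′ → r Z ≡ r Z′ → δ Z ≡ δ Z′
    δ-≡rank Z⊆Z′ eq = cong (λ b → if b then 0 else 1)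
      (≡-from-⇔ (spansX-mono Z⊆Z′) (spansX-of-≡rank Z⊆Z′ eq))

    ρ≤1+r : ∀ Z → ρ Z ≤ suc (r Z)
    ρ≤1+r Z = ≤-trans (+-monoʳ-≤ (r Z) (δ≤1 Z)) (≤-reflexive (+-comm (r Z) 1))

    ρ-mono : ∀ {Z Z′} → Z ⊆ˢ Z′ → ρ Z ≤ ρ Z′
    ρ-mono {Z} {Z′} Z⊆Z′ with m≤n⇒m<n∨m≡n (rank-mono _ _ Z⊆Z′)
    ... | inj₁ lt = ≤-trans (ρ≤1+r Z) (≤-trans lt (m≤m+n (r Z′) (δ Z′)))
    ... | inj₂ eq = ≤-reflexive (cong₂ _+_ eq (δ-≡rank Z⊆Z′ eq))

    ρ-unit : ∀ Z b → ρ (Z ∪ˢ ⁅ b ⁆) ≤ suc (ρ Z)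
    ρ-unit Z b = +-mono-≤ (rank-unit Z b) (δ-antimono (⊆-∪ˡ Z ⁅ b ⁆))

    ρ-r-submodular : ∀ Z Y → ρ (Z ∪ˢ Y) + r (Z ∩ˢ Y) ≤ ρ Z + r Y
    ρ-r-submodular Z Y = begin
      r (Z ∪ˢ Y) + δ (Z ∪ˢ Y) + r (Z ∩ˢ Y)  ≡⟨ +-swapʳ (r (Z ∪ˢ Y)) (δ (Z ∪ˢ Y)) (r (Z ∩ˢ Y)) ⟩
      r (Z ∪ˢ Y) + r (Z ∩ˢ Y) + δ (Z ∪ˢ Y)  ≤⟨ +-mono-≤ (rank-submodular Z Y) (δ-antimono (⊆-∪ˡ Z Y)) ⟩
      r Z + r Y + δ Z                       ≡⟨ +-swapʳ (r Z) (r Y) (δ Z) ⟩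
      r Z + δ Z + r Y                       ∎
      where open ≤-Reasoning

    -- A non-modular pair has slack at least 1 in submodularity, which absorbs
    -- δ (Z ∩ Y); for a modular pair X ⊆ cl Z ∩ cl Y ⊆ cl (Z ∩ Y).
    δ-submodular : ∀ Z Y → r (Z ∪ˢ Y) + r (Z ∩ˢ Y) + (δ (Z ∪ˢ Y) + δ (Z ∩ˢ Y)) ≤ r Z + r Y + (δ Z + δ Y)
    δ-submodular Z Y with spansX Z in sz | spansX Y in sy
    ... | false | false =
      +-mono-≤ (rank-submodular Z Y) (+-mono-≤ (δ≤1 _) (δ≤1 _))
    ... | false | true rewrite δ-spans (spansX-mono (⊆-∪ʳ Z Y) sy) =
      +-mono-≤ (rank-submodular Z Y) (δ≤1 _)
    ... | true | false rewrite δ-spans (spansX-mono (⊆-∪ˡ Z Y) sz) =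
      +-mono-≤ (rank-submodular Z Y) (δ≤1 _)
    ... | true | true rewrite δ-spans (spansX-mono (⊆-∪ˡ Z Y) sz)
      with m≤n⇒m<n∨m≡n (rank-submodular Z Y)
    ...   | inj₂ modular rewrite δ-spans (spansX-∩-modular modular sz sy) = +-monoˡ-≤ 0 (rank-submodular Z Y)
    ...   | inj₁ slack = begin
      r (Z ∪ˢ Y) + r (Z ∩ˢ Y) + δ (Z ∩ˢ Y)  ≤⟨ +-monoʳ-≤ _ (δ≤1 _) ⟩
      r (Z ∪ˢ Y) + r (Z ∩ˢ Y) + 1           ≡⟨ +-comm _ 1 ⟩
      suc (r (Z ∪ˢ Y) + r (Z ∩ˢ Y))         ≤⟨ slack ⟩
      r Z + r Y                             ≡⟨ +-identityʳ _ ⟨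
      r Z + r Y + 0                         ∎
      where open ≤-Reasoning

    ρ-submodular : ∀ Z Y → ρ (Z ∪ˢ Y) + ρ (Z ∩ˢ Y) ≤ ρ Z + ρ Y
    ρ-submodular Z Y = begin
      ρ (Z ∪ˢ Y) + ρ (Z ∩ˢ Y)
        ≡⟨ +-interchange (r (Z ∪ˢ Y)) (δ (Z ∪ˢ Y)) (r (Z ∩ˢ Y)) (δ (Z ∩ˢ Y)) ⟩
      r (Z ∪ˢ Y) + r (Z ∩ˢ Y) + (δ (Z ∪ˢ Y) + δ (Z ∩ˢ Y))
        ≤⟨ δ-submodular Z Y ⟩
      r Z + r Y + (δ Z + δ Y)
        ≡⟨ +-interchange (r Z) (δ Z) (r Y) (δ Y) ⟨
      ρ Z + ρ Y
        ∎
      where open ≤-Reasoning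

    ∪-∖q : ∀ {Y} Z → Y q ≡ false → ∀ a → ((Z ∪ˢ Y) ∖q) a ≡ ((Z ∖q) ∪ˢ Y) a
    ∪-∖q {Y} Z e a = trans (∧-distribʳ-∨ _ (Z a) (Y a)) (cong ((Z ∖q) a ∨_) (∖q-≗ e a))

    ∩-∖q : ∀ {Y} Z → Y q ≡ false → ∀ a → (Z ∩ˢ Y) a ≡ ((Z ∖q) ∩ˢ Y) a
    ∩-∖q {Y} Z e a = trans (sym (∖q-≗ (trans (cong (Z q ∧_) e) (∧-zeroʳ (Z q))) a))
                           (trans (∧-distribʳ-∧ _ (Z a) (Y a)) (cong ((Z ∖q) a ∧_) (∖q-≗ e a)))

    rank₊-cong : ∀ Y₁ Y₂ → (∀ a → E L₊ a ≡ true → Y₁ a ≡ Y₂ a) → r₊ Y₁ ≡ r₊ Y₂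
    rank₊-cong Y₁ Y₂ h with Y₁ q in e₁ | Y₂ q in e₂
    ... | true  | true  = ρ-cong (λ a e → cong (_∧ not (isYes (a ≟ q))) (h a (∈E⇒∈E₊ e)))
    ... | true  | false = ⊥-elim (true≢false (trans (sym (h q q∈E₊)) e₁) e₂)
    ... | false | true  = ⊥-elim (true≢false (trans (h q q∈E₊) e₂) e₁)
    ... | false | false = rank-cong _ _ (λ a e → h a (∈E⇒∈E₊ e))

    rank₊-mono : ∀ Y₁ Y₂ → Y₁ ⊆ˢ Y₂ → r₊ Y₁ ≤ r₊ Y₂
    rank₊-mono Y₁ Y₂ Y₁⊆Y₂ with Y₁ q in e₁ | Y₂ q in e₂
    ... | true  | true  = ρ-mono (∖q-mono Y₁⊆Y₂)
    ... | true  | false = ⊥-elim (true≢false (Y₁⊆Y₂ q e₁) e₂)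
    ... | false | true  = ≤-trans (rank-mono _ _ Y₁⊆Y₂∖q) (m≤m+n _ _)
      where
        Y₁⊆Y₂∖q : Y₁ ⊆ˢ (Y₂ ∖q)
        Y₁⊆Y₂∖q a h = ∖q-mono Y₁⊆Y₂ a (trans (∖q-≗ e₁ a) h)
    ... | false | false = rank-mono _ _ Y₁⊆Y₂

    rank₊-submodular-∈∉ : ∀ Y₁ Y₂ → Y₁ q ≡ true → Y₂ q ≡ false →
                          r₊ (Y₁ ∪ˢ Y₂) + r₊ (Y₁ ∩ˢ Y₂) ≤ r₊ Y₁ + r₊ Y₂
    rank₊-submodular-∈∉ Y₁ Y₂ e₁ e₂ = begin
      r₊ (Y₁ ∪ˢ Y₂) + r₊ (Y₁ ∩ˢ Y₂)
        ≡⟨ cong₂ _+_ (trans (rank₊-∈ (∨-introˡ (Y₂ q) e₁)) (ρ-≗ (∪-∖q Y₁ e₂)))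
                     (trans (rank₊-∉ (trans (cong (Y₁ q ∧_) e₂) (∧-zeroʳ _))) (rank-≗ (∩-∖q Y₁ e₂))) ⟩
      ρ ((Y₁ ∖q) ∪ˢ Y₂) + r ((Y₁ ∖q) ∩ˢ Y₂)
        ≤⟨ ρ-r-submodular (Y₁ ∖q) Y₂ ⟩
      ρ (Y₁ ∖q) + r Y₂
        ≡⟨ cong₂ _+_ (rank₊-∈ e₁) (rank₊-∉ e₂) ⟨
      r₊ Y₁ + r₊ Y₂
        ∎
      where open ≤-Reasoning

    rank₊-submodular : ∀ Y₁ Y₂ → r₊ (Y₁ ∪ˢ Y₂) + r₊ (Y₁ ∩ˢ Y₂) ≤ r₊ Y₁ + r₊ Y₂
    rank₊-submodular Y₁ Y₂ = bool-cases (Y₁ q)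
      (λ e₁ → bool-cases (Y₂ q) (∈∈ e₁) (rank₊-submodular-∈∉ Y₁ Y₂ e₁))
      (λ e₁ → bool-cases (Y₂ q) (λ e₂ → ∉∈ e₁ e₂) (∉∉ e₁))
      where
        open ≤-Reasoning
        Submodular : Set
        Submodular = r₊ (Y₁ ∪ˢ Y₂) + r₊ (Y₁ ∩ˢ Y₂) ≤ r₊ Y₁ + r₊ Y₂
        ∈∈ : Y₁ q ≡ true → Y₂ q ≡ true → Submodular
        ∈∈ e₁ e₂ = begin
          r₊ (Y₁ ∪ˢ Y₂) + r₊ (Y₁ ∩ˢ Y₂)
            ≡⟨ cong₂ _+_ (trans (rank₊-∈ (∨-introˡ (Y₂ q) e₁)) (ρ-≗ (λ a → ∧-distribʳ-∨ _ (Y₁ a) (Y₂ a))))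
                         (trans (rank₊-∈ (cong₂ _∧_ e₁ e₂)) (ρ-≗ (λ a → ∧-distribʳ-∧ _ (Y₁ a) (Y₂ a)))) ⟩
          ρ ((Y₁ ∖q) ∪ˢ (Y₂ ∖q)) + ρ ((Y₁ ∖q) ∩ˢ (Y₂ ∖q))
            ≤⟨ ρ-submodular (Y₁ ∖q) (Y₂ ∖q) ⟩
          ρ (Y₁ ∖q) + ρ (Y₂ ∖q)
            ≡⟨ cong₂ _+_ (rank₊-∈ e₁) (rank₊-∈ e₂) ⟨
          r₊ Y₁ + r₊ Y₂
            ∎
        ∉∈ : Y₁ q ≡ false → Y₂ q ≡ true → Submodular
        ∉∈ e₁ e₂ = begin
          r₊ (Y₁ ∪ˢ Y₂) + r₊ (Y₁ ∩ˢ Y₂)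
            ≡⟨ cong₂ _+_ (rank₊-cong _ _ (λ a _ → ∨-comm (Y₁ a) (Y₂ a)))
                         (rank₊-cong _ _ (λ a _ → ∧-comm (Y₁ a) (Y₂ a))) ⟩
          r₊ (Y₂ ∪ˢ Y₁) + r₊ (Y₂ ∩ˢ Y₁)  ≤⟨ rank₊-submodular-∈∉ Y₂ Y₁ e₂ e₁ ⟩
          r₊ Y₂ + r₊ Y₁                  ≡⟨ +-comm (r₊ Y₂) (r₊ Y₁) ⟩
          r₊ Y₁ + r₊ Y₂                  ∎
        ∉∉ : Y₁ q ≡ false → Y₂ q ≡ false → Submodular
        ∉∉ e₁ e₂ = subst₂ _≤_
          (sym (cong₂ _+_ (rank₊-∉ (trans (cong (Y₁ q ∨_) e₂) (trans (∨-identityʳ _) e₁)))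
                          (rank₊-∉ (trans (cong (Y₁ q ∧_) e₂) (∧-zeroʳ _)))))
          (sym (cong₂ _+_ (rank₊-∉ e₁) (rank₊-∉ e₂)))
          (rank-submodular Y₁ Y₂)

    rank₊-unit : ∀ Y a → r₊ (Y ∪ˢ ⁅ a ⁆) ≤ suc (r₊ Y)
    rank₊-unit Y a = bool-cases (Y q) (λ e → q∈Y e (a ≟ q)) (λ e → q∉Y e (a ≟ q))
      where
        open ≤-Reasoning
        q∈Y : Y q ≡ true → Dec (a ≡ q) → r₊ (Y ∪ˢ ⁅ a ⁆) ≤ suc (r₊ Y)
        q∈Y e (yes refl) = begin
          r₊ (Y ∪ˢ ⁅ q ⁆)        ≡⟨ rank₊-∈ (∨-introˡ _ e) ⟩
          ρ ((Y ∪ˢ ⁅ q ⁆) ∖q)    ≡⟨ ρ-≗ (λ b → [x∨y]∧¬y≡x∧¬y (Y b) (isYes (b ≟ q))) ⟩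
          ρ (Y ∖q)               ≡⟨ rank₊-∈ e ⟨
          r₊ Y                   ≤⟨ n≤1+n _ ⟩
          suc (r₊ Y)             ∎
        q∈Y e (no a≢q) = begin
          r₊ (Y ∪ˢ ⁅ a ⁆)        ≡⟨ rank₊-∈ (∨-introˡ _ e) ⟩
          ρ ((Y ∪ˢ ⁅ a ⁆) ∖q)    ≡⟨ ρ-≗ (∪-∖q Y (⁅⁆-other (λ q≡a → a≢q (sym q≡a)))) ⟩
          ρ ((Y ∖q) ∪ˢ ⁅ a ⁆)    ≤⟨ ρ-unit (Y ∖q) a ⟩
          suc (ρ (Y ∖q))         ≡⟨ cong suc (rank₊-∈ e) ⟨
          suc (r₊ Y)             ∎
        q∉Y : Y q ≡ false → Dec (a ≡ q) → r₊ (Y ∪ˢ ⁅ a ⁆) ≤ suc (r₊ Y)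
        q∉Y e (yes refl) = begin
          r₊ (Y ∪ˢ ⁅ q ⁆)        ≡⟨ rank₊-∈ (∨-introʳ (Y q) (⁅⁆-self q)) ⟩
          ρ ((Y ∪ˢ ⁅ q ⁆) ∖q)    ≡⟨ ρ-≗ (λ b → trans ([x∨y]∧¬y≡x∧¬y (Y b) _) (∖q-≗ e b)) ⟩
          ρ Y                    ≤⟨ ρ≤1+r Y ⟩
          suc (r Y)              ≡⟨ cong suc (rank₊-∉ e) ⟨
          suc (r₊ Y)             ∎
        q∉Y e (no a≢q) = begin
          r₊ (Y ∪ˢ ⁅ a ⁆)        ≡⟨ rank₊-∉ (cong₂ _∨_ e (⁅⁆-other (λ q≡a → a≢q (sym q≡a)))) ⟩
          r (Y ∪ˢ ⁅ a ⁆)         ≤⟨ rank-unit Y a ⟩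
          suc (r Y)              ≡⟨ cong suc (rank₊-∉ e) ⟨
          suc (r₊ Y)             ∎

    principalExt-isRankFunction : IsRankFunction L₊
    principalExt-isRankFunction = record
      { rank-cong = rank₊-cong ; rank-mono = rank₊-mono
      ; rank-submodular = rank₊-submodular ; rank-unit = rank₊-unit }

  isRankFunction-≗ : ∀ {L L′} → IsRankFunction L → (∀ a → E L′ a ≡ E L a) →
                     (∀ Y → rank L′ Y ≡ rank L Y) → IsRankFunction L′
  isRankFunction-≗ {L} {L′} isRank E≗ r≗ = record
    { rank-cong       = λ X Y h → trans (r≗ X) (trans (rank-cong X Y (λ a e → h a (trans (E≗ a) e))) (sym (r≗ Y)))
    ; rank-mono       = λ X Y X⊆Y → subst₂ _≤_ (sym (r≗ X)) (sym (r≗ Y)) (rank-mono X Y X⊆Y)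
    ; rank-submodular = λ X Y → subst₂ _≤_ (sym (cong₂ _+_ (r≗ _) (r≗ _))) (sym (cong₂ _+_ (r≗ X) (r≗ Y)))
                                            (rank-submodular X Y)
    ; rank-unit       = λ X a → subst₂ _≤_ (sym (r≗ _)) (sym (cong suc (r≗ X))) (rank-unit X a) }
    where open IsRankFunction isRank

  E-contract : ∀ M P a → E (contract _≟_ M P) a ≡ not (P a) ∧ E M a
  E-contract M P a = elemᵇ-filter (λ b → not (P b)) (elems M) a

  contract-isRankFunction : ∀ {M} P → IsRankFunction M → IsRankFunction (contract _≟_ M P)
  contract-isRankFunction {M} P isRank = record
    { rank-cong = rank-cong′ ; rank-mono = rank-mono′
    ; rank-submodular = rank-submodular′ ; rank-unit = rank-unit′ }
    where
      open IsRankFunction isRank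
      open Closure isRank
      r : Subset A → ℕ
      r = rank M
      r′ : Subset A → ℕ
      r′ = rank (contract _≟_ M P)

      rank-cong′ : ∀ X Y → (∀ a → E (contract _≟_ M P) a ≡ true → X a ≡ Y a) → r′ X ≡ r′ Y
      rank-cong′ X Y h = cong (_∸ r P) (rank-cong _ _ XP≗YP)
        where
          XP≗YP : ∀ a → E M a ≡ true → (X ∪ˢ P) a ≡ (Y ∪ˢ P) a
          XP≗YP a e with P a in pa
          ... | true  = trans (∨-zeroʳ (X a)) (sym (∨-zeroʳ (Y a)))
          ... | false = cong (_∨ false) (h a (trans (E-contract M P a) (trans (cong (λ z → not z ∧ E M a) pa) e)))

      rank-mono′ : ∀ X Y → X ⊆ˢ Y → r′ X ≤ r′ Y
      rank-mono′ X Y X⊆Y = ∸-monoˡ-≤ (r P) (rank-mono _ _ (∪-monoˡ-⊆ P X⊆Y))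

      rank-submodular′ : ∀ X Y → r′ (X ∪ˢ Y) + r′ (X ∩ˢ Y) ≤ r′ X + r′ Y
      rank-submodular′ X Y = begin
        r′ (X ∪ˢ Y) + r′ (X ∩ˢ Y)
          ≡⟨ [m+n]∸[o+p]≡[m∸o]+[n∸p] (rank-∪-mono P _) (rank-∪-mono P _) ⟨
        r ((X ∪ˢ Y) ∪ˢ P) + r ((X ∩ˢ Y) ∪ˢ P) ∸ (r P + r P)
          ≡⟨ cong (λ z → z ∸ (r P + r P)) (cong₂ _+_ (rank-≗ (λ a → ∨-distribʳ-∨ (P a) (X a) (Y a)))
                                                     (rank-≗ (λ a → ∨-distribʳ-∧ (P a) (X a) (Y a)))) ⟩
        r ((X ∪ˢ P) ∪ˢ (Y ∪ˢ P)) + r ((X ∪ˢ P) ∩ˢ (Y ∪ˢ P)) ∸ (r P + r P)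
          ≤⟨ ∸-monoˡ-≤ (r P + r P) (rank-submodular (X ∪ˢ P) (Y ∪ˢ P)) ⟩
        r (X ∪ˢ P) + r (Y ∪ˢ P) ∸ (r P + r P)
          ≡⟨ [m+n]∸[o+p]≡[m∸o]+[n∸p] (rank-∪-mono P X) (rank-∪-mono P Y) ⟩
        r′ X + r′ Y
          ∎
        where open ≤-Reasoning

      rank-unit′ : ∀ X a → r′ (X ∪ˢ ⁅ a ⁆) ≤ suc (r′ X)
      rank-unit′ X a = begin
        r ((X ∪ˢ ⁅ a ⁆) ∪ˢ P) ∸ r P   ≡⟨ cong (_∸ r P) (rank-≗ (λ b → ∨-swapʳ (X b) (⁅ a ⁆ b) (P b))) ⟩
        r ((X ∪ˢ P) ∪ˢ ⁅ a ⁆) ∸ r P   ≤⟨ ∸-monoˡ-≤ (r P) (rank-unit (X ∪ˢ P) a) ⟩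
        suc (r (X ∪ˢ P)) ∸ r P        ≡⟨ +-∸-assoc 1 (rank-∪-mono P X) ⟩
        suc (r′ X)                    ∎
        where open ≤-Reasoning

  E-⊕ : ∀ L₁ L₂ a → E (_⊕ᴹ_ _≟_ L₁ L₂) a ≡ E L₁ a ∨ E L₂ a
  E-⊕ L₁ L₂ a = any-++ _ (elems L₁) (elems L₂)

  module _ {L : RawMatroid A} (isRank : IsRankFunction L) where
    open IsRankFunction isRank
    open Closure isRank

    ∩E-≗ : ∀ X → rank L (X ∩ˢ E L) ≡ rank L X
    ∩E-≗ X = rank-cong _ _ (λ a e → trans (cong (X a ∧_) e) (∧-identityʳ (X a)))

    ∩E-unit : ∀ X a → rank L ((X ∪ˢ ⁅ a ⁆) ∩ˢ E L) ≤ suc (rank L (X ∩ˢ E L))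
    ∩E-unit X a = subst₂ _≤_ (sym (∩E-≗ _)) (sym (cong suc (∩E-≗ X))) (rank-unit X a)

    ∩E-∉ : ∀ X a → E L a ≡ false → rank L ((X ∪ˢ ⁅ a ⁆) ∩ˢ E L) ≡ rank L (X ∩ˢ E L)
    ∩E-∉ X a a∉E = rank-≗ Xa∩E≗X∩E
      where
        Xa∩E≗X∩E : ∀ b → ((X ∪ˢ ⁅ a ⁆) ∩ˢ E L) b ≡ (X ∩ˢ E L) b
        Xa∩E≗X∩E b with ⁅ a ⁆ b in e
        ... | false = cong (_∧ E L b) (∨-identityʳ (X b))
        ... | true rewrite ⁅⁆-sound e | a∉E = trans (∧-zeroʳ _) (sym (∧-zeroʳ _))

  ⊕-isRankFunction : ∀ {L₁ L₂} → IsRankFunction L₁ → IsRankFunction L₂ →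
                     (∀ a → E L₁ a ≡ true → E L₂ a ≡ false) → IsRankFunction (_⊕ᴹ_ _≟_ L₁ L₂)
  ⊕-isRankFunction {L₁} {L₂} isRank₁ isRank₂ disjoint = record
    { rank-cong = rank-cong′ ; rank-mono = rank-mono′
    ; rank-submodular = rank-submodular′ ; rank-unit = rank-unit′ }
    where
      module R₁ = IsRankFunction isRank₁
      module R₂ = IsRankFunction isRank₂
      module C₁ = Closure isRank₁
      module C₂ = Closure isRank₂
      r : Subset A → ℕ
      r = rank (_⊕ᴹ_ _≟_ L₁ L₂)
      r₁ : Subset A → ℕ
      r₁ = rank L₁
      r₂ : Subset A → ℕ
      r₂ = rank L₂

      ∩-≗ : ∀ L′ {X Y} → (∀ a → E L′ a ≡ true → X a ≡ Y a) → ∀ a → (X ∩ˢ E L′) a ≡ (Y ∩ˢ E L′) a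
      ∩-≗ L′ {X} {Y} h a with E L′ a in e
      ... | true  = trans (∧-identityʳ _) (trans (h a e) (sym (∧-identityʳ _)))
      ... | false = trans (∧-zeroʳ _) (sym (∧-zeroʳ _))

      rank-cong′ : ∀ X Y → (∀ a → E (_⊕ᴹ_ _≟_ L₁ L₂) a ≡ true → X a ≡ Y a) → r X ≡ r Y
      rank-cong′ X Y h = cong₂ _+_ (C₁.rank-≗ (∩-≗ L₁ (λ a e → h a (trans (E-⊕ L₁ L₂ a) (∨-introˡ _ e)))))
                              (C₂.rank-≗ (∩-≗ L₂ (λ a e → h a (trans (E-⊕ L₁ L₂ a) (∨-introʳ _ e)))))

      rank-mono′ : ∀ X Y → X ⊆ˢ Y → r X ≤ r Y
      rank-mono′ X Y X⊆Y = +-mono-≤ (R₁.rank-mono _ _ (∩-monoˡ-⊆ (E L₁) X⊆Y))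
                                    (R₂.rank-mono _ _ (∩-monoˡ-⊆ (E L₂) X⊆Y))

      submodularᵢ : ∀ {L′} → IsRankFunction L′ → ∀ X Y →
                    rank L′ ((X ∪ˢ Y) ∩ˢ E L′) + rank L′ ((X ∩ˢ Y) ∩ˢ E L′) ≤
                    rank L′ (X ∩ˢ E L′) + rank L′ (Y ∩ˢ E L′)
      submodularᵢ {L′} isRank X Y = subst (_≤ rank L′ (X ∩ˢ E L′) + rank L′ (Y ∩ˢ E L′))
        (cong₂ _+_ (rank-≗ (λ a → sym (∧-distribʳ-∨ (E L′ a) (X a) (Y a))))
                   (rank-≗ (λ a → sym (∧-distribʳ-∧ (E L′ a) (X a) (Y a)))))
        (rank-submodular (X ∩ˢ E L′) (Y ∩ˢ E L′))
        where
          open IsRankFunction isRank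
          open Closure isRank

      rank-submodular′ : ∀ X Y → r (X ∪ˢ Y) + r (X ∩ˢ Y) ≤ r X + r Y
      rank-submodular′ X Y = begin
        r (X ∪ˢ Y) + r (X ∩ˢ Y)
          ≡⟨ +-interchange (r₁ ((X ∪ˢ Y) ∩ˢ E L₁)) (r₂ ((X ∪ˢ Y) ∩ˢ E L₂))
                           (r₁ ((X ∩ˢ Y) ∩ˢ E L₁)) (r₂ ((X ∩ˢ Y) ∩ˢ E L₂)) ⟩
        (r₁ ((X ∪ˢ Y) ∩ˢ E L₁) + r₁ ((X ∩ˢ Y) ∩ˢ E L₁)) +
        (r₂ ((X ∪ˢ Y) ∩ˢ E L₂) + r₂ ((X ∩ˢ Y) ∩ˢ E L₂))
          ≤⟨ +-mono-≤ (submodularᵢ isRank₁ X Y) (submodularᵢ isRank₂ X Y) ⟩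
        (r₁ (X ∩ˢ E L₁) + r₁ (Y ∩ˢ E L₁)) + (r₂ (X ∩ˢ E L₂) + r₂ (Y ∩ˢ E L₂))
          ≡⟨ +-interchange (r₁ (X ∩ˢ E L₁)) (r₂ (X ∩ˢ E L₂)) (r₁ (Y ∩ˢ E L₁)) (r₂ (Y ∩ˢ E L₂)) ⟨
        r X + r Y ∎
        where open ≤-Reasoning

      rank-unit′ : ∀ X a → r (X ∪ˢ ⁅ a ⁆) ≤ suc (r X)
      rank-unit′ X a = bool-cases (E L₁ a)
        (λ e → +-mono-≤ (∩E-unit isRank₁ X a) (≤-reflexive (∩E-∉ isRank₂ X a (disjoint a e))))
        (λ e → subst (r (X ∪ˢ ⁅ a ⁆) ≤_) (+-suc _ _)
                 (+-mono-≤ (≤-reflexive (∩E-∉ isRank₁ X a e)) (∩E-unit isRank₂ X a)))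

  count-⁅⁆≤1 : ∀ a xs → Unique xs → length (filterᵇ ⁅ a ⁆ xs) ≤ 1
  count-⁅⁆≤1 a []       _          = z≤n
  count-⁅⁆≤1 a (x ∷ xs) (x∉ ∷ uxs) with x ≟ a
  ... | yes refl = s≤s (≤-reflexive (none xs x∉))
    where
      none : ∀ ys → All (λ b → ¬ x ≡ b) ys → length (filterᵇ ⁅ x ⁆ ys) ≡ 0
      none []       []         = refl
      none (y ∷ ys) (x≢y ∷ ps) with y ≟ x
      ... | yes y≡x = ⊥-elim (x≢y (sym y≡x))
      ... | no _ = none ys ps
  ... | no _ = count-⁅⁆≤1 a xs uxs

  isMatroid⇒isRankFunction : ∀ {M} → IsMatroid _≟_ M → IsRankFunction M
  isMatroid⇒isRankFunction {M} isMatroid = record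
    { rank-cong = ext ; rank-mono = rank-mono′ ; rank-submodular = rank-submodular′ ; rank-unit = rank-unit′ }
    where
      open IsMatroid isMatroid
      r : Subset A → ℕ
      r = rank M

      ∩E⊆E : ∀ X → (X ∩ˢ E M) ⊆ˢ E M
      ∩E⊆E X a h = ∧-elimʳ {X a} h

      ∩E-≗′ : ∀ X → r X ≡ r (X ∩ˢ E M)
      ∩E-≗′ X = ext _ _ (λ a e → trans (sym (∧-identityʳ (X a))) (cong (X a ∧_) (sym e)))

      rank-≗′ : ∀ {Z Z′} → (∀ a → Z a ≡ Z′ a) → r Z ≡ r Z′
      rank-≗′ h = ext _ _ (λ a _ → h a)

      rank-mono′ : ∀ X Y → X ⊆ˢ Y → r X ≤ r Y
      rank-mono′ X Y X⊆Y = subst₂ _≤_ (sym (∩E-≗′ X)) (sym (∩E-≗′ Y))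
        (R2 (X ∩ˢ E M) (Y ∩ˢ E M) (∩-monoˡ-⊆ (E M) X⊆Y) (∩E⊆E Y))

      rank-submodular′ : ∀ X Y → r (X ∪ˢ Y) + r (X ∩ˢ Y) ≤ r X + r Y
      rank-submodular′ X Y = subst₂ _≤_
        (cong₂ _+_ (trans (rank-≗′ (λ a → sym (∧-distribʳ-∨ (E M a) (X a) (Y a)))) (sym (∩E-≗′ (X ∪ˢ Y))))
                   (trans (rank-≗′ (λ a → sym (∧-distribʳ-∧ (E M a) (X a) (Y a)))) (sym (∩E-≗′ (X ∩ˢ Y)))))
        (sym (cong₂ _+_ (∩E-≗′ X) (∩E-≗′ Y)))
        (R3 (X ∩ˢ E M) (Y ∩ˢ E M) (∩E⊆E X) (∩E⊆E Y))

      rank-unit′ : ∀ X a → r (X ∪ˢ ⁅ a ⁆) ≤ suc (r X)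
      rank-unit′ X a = bool-cases (E M a) a∈E a∉E
        where
          open ≤-Reasoning
          a∉E : E M a ≡ false → r (X ∪ˢ ⁅ a ⁆) ≤ suc (r X)
          a∉E e = ≤-trans (≤-reflexive (ext _ _ Xa≗X)) (n≤1+n _)
            where
              Xa≗X : ∀ b → E M b ≡ true → (X ∪ˢ ⁅ a ⁆) b ≡ X b
              Xa≗X b eb with b ≟ a
              ... | yes refl = ⊥-elim (true≢false eb e)
              ... | no _ = ∨-identityʳ (X b)
          a∈E : E M a ≡ true → r (X ∪ˢ ⁅ a ⁆) ≤ suc (r X)
          a∈E e = begin
            r (X ∪ˢ ⁅ a ⁆)                                      ≡⟨ ext _ _ Xa≗X∩Ea ⟩
            r ((X ∩ˢ E M) ∪ˢ ⁅ a ⁆)                             ≤⟨ m≤m+n _ _ ⟩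
            r ((X ∩ˢ E M) ∪ˢ ⁅ a ⁆) + r ((X ∩ˢ E M) ∩ˢ ⁅ a ⁆)  ≤⟨ R3 (X ∩ˢ E M) ⁅ a ⁆ (∩E⊆E X) a⊆E ⟩
            r (X ∩ˢ E M) + r ⁅ a ⁆                              ≤⟨ +-monoʳ-≤ _ r⁅a⁆≤1 ⟩
            r (X ∩ˢ E M) + 1                                    ≡⟨ +-comm _ 1 ⟩
            suc (r (X ∩ˢ E M))                                  ≡⟨ cong suc (∩E-≗′ X) ⟨
            suc (r X)                                           ∎
            where
              a⊆E : ⁅ a ⁆ ⊆ˢ E M
              a⊆E b h rewrite ⁅⁆-sound h = e
              r⁅a⁆≤1 : r ⁅ a ⁆ ≤ 1
              r⁅a⁆≤1 = ≤-trans (R1 ⁅ a ⁆ a⊆E) (count-⁅⁆≤1 a (elems M) unique)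
              Xa≗X∩Ea : ∀ b → E M b ≡ true → (X ∪ˢ ⁅ a ⁆) b ≡ ((X ∩ˢ E M) ∪ˢ ⁅ a ⁆) b
              Xa≗X∩Ea b eb rewrite eb | ∧-identityʳ (X b) = refl

module Image {A B : Set} (_≟A_ : DecidableEquality A) (_≟B_ : DecidableEquality B) (f : A → B)
             (f-injective : ∀ {x y} → f x ≡ f y → x ≡ y)
             (preimage? : ∀ w → (Σ A λ u → f u ≡ w) ⊎ (∀ u → ¬ f u ≡ w)) where
  private
    module RA = RankFunctions _≟A_
    module RB = RankFunctions _≟B_

  image : RawMatroid A → RawMatroid B
  image N = record { elems = map f (elems N) ; rank = λ Y → rank N (λ u → Y (f u)) }

  ≟-image : ∀ u b → isYes (f u ≟B f b) ≡ isYes (u ≟A b)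
  ≟-image u b with f u ≟B f b | u ≟A b
  ... | yes _  | yes _    = refl
  ... | yes p  | no u≢b   = ⊥-elim (u≢b (f-injective p))
  ... | no fu≢ | yes refl = ⊥-elim (fu≢ refl)
  ... | no _   | no _     = refl

  E-image : ∀ N u → RB.E (image N) (f u) ≡ RA.E N u
  E-image N u = go (elems N)
    where
      go : ∀ xs → any (λ b → isYes (f u ≟B b)) (map f xs) ≡ any (λ b → isYes (u ≟A b)) xs
      go []       = refl
      go (x ∷ xs) = cong₂ _∨_ (≟-image u x) (go xs)

  E-image⁻¹ : ∀ N w → RB.E (image N) w ≡ true → Σ A (λ u → f u ≡ w × RA.E N u ≡ true)
  E-image⁻¹ N w = go (elems N)
    where
      go : ∀ xs → any (λ b → isYes (w ≟B b)) (map f xs) ≡ true →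
           Σ A (λ u → f u ≡ w × any (λ b → isYes (u ≟A b)) xs ≡ true)
      go (x ∷ xs) h with w ≟B f x
      ... | yes p = x , sym p , ∨-introˡ _ (RA.⁅⁆-self x)
      ... | no _ with go xs h
      ...   | u , e , m = u , e , ∨-introʳ _ m

  image-isRankFunction : ∀ {N} → RA.IsRankFunction N → RB.IsRankFunction (image N)
  image-isRankFunction {N} isRank = record
    { rank-cong       = λ X Y h → rank-cong _ _ (λ a e → h (f a) (trans (E-image N a) e))
    ; rank-mono       = λ X Y X⊆Y → rank-mono _ _ (λ a h → X⊆Y (f a) h)
    ; rank-submodular = λ X Y → rank-submodular _ _
    ; rank-unit       = rank-unit′ }
    where
      open RA.IsRankFunction isRank
      open RA.Closure isRank
      rank-unit′ : ∀ X w → rank N (λ u → (X ∪ˢ RB.⁅ w ⁆) (f u)) ≤ suc (rank N (λ u → X (f u)))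
      rank-unit′ X w with preimage? w
      ... | inj₁ (u , refl) = ≤-trans (≤-reflexive (rank-≗ (λ b → cong (X (f b) ∨_) (≟-image b u)))) (rank-unit _ u)
      ... | inj₂ no-preimage = ≤-trans (≤-reflexive (rank-≗ Xw≗X)) (n≤1+n _)
        where
          Xw≗X : ∀ b → (X (f b) ∨ isYes (f b ≟B w)) ≡ X (f b)
          Xw≗X b with f b ≟B w
          ... | yes p = ⊥-elim (no-preimage b p)
          ... | no _ = ∨-identityʳ _

module Bonding {U : Set} (_≟_ : DecidableEquality U) where
  𝕎 : Set
  𝕎 = W _≟_

  _≟𝕎_ : DecidableEquality 𝕎
  _≟𝕎_ = _≟W_ _≟_

  module RU = RankFunctions _≟_
  open RankFunctions _≟𝕎_

  t̂ ŝ q̂ : U → 𝕎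
  t̂ u = inj₁ u
  ŝ u = inj₂ (inj₁ u)
  q̂ u = inj₂ (inj₂ u)

  ≟-t̂ : ∀ u v → isYes (t̂ u ≟𝕎 t̂ v) ≡ isYes (u ≟ v)
  ≟-t̂ u v with u ≟ v
  ... | yes refl = refl
  ... | no _ = refl

  ≟-ŝ : ∀ u v → isYes (ŝ u ≟𝕎 ŝ v) ≡ isYes (u ≟ v)
  ≟-ŝ u v with u ≟ v
  ... | yes refl = refl
  ... | no _ = refl

  ≟-q̂ : ∀ u v → isYes (q̂ u ≟𝕎 q̂ v) ≡ isYes (u ≟ v)
  ≟-q̂ u v with u ≟ v
  ... | yes refl = refl
  ... | no _ = refl

  relabel : Subset U → U → 𝕎
  relabel T u = if T u then ŝ u else t̂ u

  relabel⁻¹ : Subset U → Subset 𝕎 → Subset U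
  relabel⁻¹ T Z u = if T u then Z (ŝ u) else Z (t̂ u)

  relabel-∈ : ∀ {T u} → T u ≡ true → relabel T u ≡ ŝ u
  relabel-∈ {T} {u} e = cong (λ c → if c then ŝ u else t̂ u) e

  relabel-∉ : ∀ {T u} → T u ≡ false → relabel T u ≡ t̂ u
  relabel-∉ {T} {u} e = cong (λ c → if c then ŝ u else t̂ u) e

  relabel-injective : ∀ T {x y} → relabel T x ≡ relabel T y → x ≡ y
  relabel-injective T {x} {y} e with T x | T y | e
  ... | true  | true  | refl = refl
  ... | false | false | refl = refl

  relabel≢q̂ : ∀ T u v → ¬ relabel T u ≡ q̂ v
  relabel≢q̂ T u v e with T u | e
  ... | true  | ()
  ... | false | ()

  relabel-preimage? : ∀ T w → (Σ U λ u → relabel T u ≡ w) ⊎ (∀ u → ¬ relabel T u ≡ w)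
  relabel-preimage? T (inj₁ u) = bool-cases (T u)
    (λ e → inj₂ (λ v ev → none v ev e)) (λ e → inj₁ (u , relabel-∉ {T} e))
    where
      none : ∀ v → relabel T v ≡ t̂ u → T u ≡ true → ⊥
      none v ev Tu with T v in Tv | ev
      ... | false | refl = true≢false Tu Tv
  relabel-preimage? T (inj₂ (inj₁ u)) = bool-cases (T u)
    (λ e → inj₁ (u , relabel-∈ {T} e)) (λ e → inj₂ (λ v ev → none v ev e))
    where
      none : ∀ v → relabel T v ≡ ŝ u → T u ≡ false → ⊥
      none v ev Tu with T v in Tv | ev
      ... | true | refl = true≢false Tv Tu
  relabel-preimage? T (inj₂ (inj₂ u)) = inj₂ (λ v → relabel≢q̂ T v u)

  t̂-preimage? : ∀ w → (Σ U λ u → t̂ u ≡ w) ⊎ (∀ u → ¬ t̂ u ≡ w)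
  t̂-preimage? (inj₁ u) = inj₁ (u , refl)
  t̂-preimage? (inj₂ w) = inj₂ (λ u ())

  t̂-injective : ∀ {u v} → t̂ u ≡ t̂ v → u ≡ v
  t̂-injective refl = refl

  module Lift = Image _≟_ _≟𝕎_ t̂ t̂-injective t̂-preimage?
  module Relabel (T : Subset U) = Image _≟_ _≟𝕎_ (relabel T) (relabel-injective T) (relabel-preimage? T)

  M⊕N′ : RawMatroid U → RawMatroid U → RawMatroid 𝕎
  M⊕N′ M N = _⊕ᴹ_ _≟𝕎_ (liftM _≟_ M) (relabelN _≟_ (common _≟_ M N) N)

  pair : U → Subset 𝕎
  pair t = ⁅ t̂ t ⁆ ∪ˢ ⁅ ŝ t ⁆

  flat : RawMatroid 𝕎 → U → Subset 𝕎
  flat B t = cl _≟𝕎_ B (pair t)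

  extendAt : RawMatroid 𝕎 → RawMatroid 𝕎 → U → RawMatroid 𝕎
  extendAt B L t = principalExt _≟𝕎_ L (flat B t) (q̂ t)

  H : RawMatroid U → RawMatroid U → RawMatroid 𝕎
  H M N = foldl (extendAt (M⊕N′ M N)) (M⊕N′ M N) (filterᵇ (common _≟_ M N) (elems M))

  embed : Subset U → Subset 𝕎
  embed X (inj₁ u) = X u
  embed X (inj₂ _) = false

  rank-bond : ∀ M N X → IsRankFunction (H M N) →
              rank (bond _≟_ M N) X ≡
              rank (H M N) (embed X ∪ˢ Qset _≟_ (common _≟_ M N)) ∸ rank (H M N) (Qset _≟_ (common _≟_ M N))
  rank-bond M N X isRank = cong (_∸ rank (H M N) (Qset _≟_ (common _≟_ M N)))
    (Closure.rank-≗ isRank (λ { (inj₁ u) → refl ; (inj₂ _) → refl }))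

  E-M⊕N′-t̂ : ∀ M N u → E (M⊕N′ M N) (t̂ u) ≡ RU.E M u ∨ RU.E N u
  E-M⊕N′-t̂ M N u = trans (E-⊕ M̂ N̂ (t̂ u)) (bool-cases (T u) u∈T u∉T)
    where
      T = common _≟_ M N
      M̂ = liftM _≟_ M
      N̂ = relabelN _≟_ T N
      u∈T : T u ≡ true → E M̂ (t̂ u) ∨ E N̂ (t̂ u) ≡ RU.E M u ∨ RU.E N u
      u∈T Tu = trans (∨-introˡ (E N̂ (t̂ u)) (trans (Lift.E-image M u) (∧-elimˡ Tu)))
                     (sym (∨-introˡ (RU.E N u) (∧-elimˡ Tu)))
      u∉T : T u ≡ false → E M̂ (t̂ u) ∨ E N̂ (t̂ u) ≡ RU.E M u ∨ RU.E N u
      u∉T Tu = cong₂ _∨_ (Lift.E-image M u) (trans (cong (E N̂) (sym (relabel-∉ {T} Tu))) (Relabel.E-image T N u))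

  E-extendAt-t̂ : ∀ B L ts u → E (foldl (extendAt B) L ts) (t̂ u) ≡ E L (t̂ u)
  E-extendAt-t̂ B L []       u = refl
  E-extendAt-t̂ B L (t ∷ ts) u = trans (E-extendAt-t̂ B (extendAt B L t) ts u)
                                       (trans (any-++ _ (elems L) (q̂ t ∷ [])) (∨-identityʳ _))

  E-bond : ∀ M N u → RU.E (bond _≟_ M N) u ≡ RU.E M u ∨ RU.E N u
  E-bond M N u = begin
    RU.E (bond _≟_ M N) u         ≡⟨ elemᵇ-mapMaybe (λ _ → refl) (λ _ → refl) (elems H/Q∖S) ⟩
    E H/Q∖S (t̂ u)                 ≡⟨ elemᵇ-filter (λ a → not (S a)) (elems H/Q) (t̂ u) ⟩
    E H/Q (t̂ u)                   ≡⟨ elemᵇ-filter (λ a → not (Q a)) (elems (H M N)) (t̂ u) ⟩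
    E (H M N) (t̂ u)               ≡⟨ E-extendAt-t̂ (M⊕N′ M N) (M⊕N′ M N) (filterᵇ T (elems M)) u ⟩
    E (M⊕N′ M N) (t̂ u)            ≡⟨ E-M⊕N′-t̂ M N u ⟩
    RU.E M u ∨ RU.E N u           ∎
    where
      open ≡-Reasoning
      T = common _≟_ M N
      Q S : Subset 𝕎
      Q = Qset _≟_ T
      S = Sset _≟_ T
      H/Q H/Q∖S : RawMatroid 𝕎
      H/Q = contract _≟𝕎_ (H M N) Q
      H/Q∖S = delete _≟𝕎_ H/Q S
      elemᵇ-mapMaybe : ∀ {g : 𝕎 → Maybe U} → (∀ v → g (inj₁ v) ≡ just v) → (∀ x → g (inj₂ x) ≡ nothing) →
                       ∀ ys → RU.elemᵇ (mapMaybe g ys) u ≡ elemᵇ ys (t̂ u)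
      elemᵇ-mapMaybe g₁ g₂ [] = refl
      elemᵇ-mapMaybe {g} g₁ g₂ (inj₁ v ∷ ys) rewrite g₁ v = cong₂ _∨_ (sym (≟-t̂ u v)) (elemᵇ-mapMaybe g₁ g₂ ys)
      elemᵇ-mapMaybe {g} g₁ g₂ (inj₂ x ∷ ys) rewrite g₂ x = elemᵇ-mapMaybe g₁ g₂ ys

  module DirectSum {M N : RawMatroid U} (rM : RU.IsRankFunction M) (rN : RU.IsRankFunction N) where
    T : Subset U
    T = common _≟_ M N

    M̂ N̂ : RawMatroid 𝕎
    M̂ = liftM _≟_ M
    N̂ = relabelN _≟_ T N

    M̂-isRankFunction : IsRankFunction M̂
    M̂-isRankFunction = Lift.image-isRankFunction rM

    N̂-isRankFunction : IsRankFunction N̂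
    N̂-isRankFunction = isRankFunction-≗ (Relabel.image-isRankFunction T rN) (λ a → refl)
                                        (λ Y → RU.Closure.rank-≗ rN (pullback≗ Y))
      where
        pullback≗ : ∀ Y u → relabel⁻¹ T Y u ≡ Y (relabel T u)
        pullback≗ Y u with T u
        ... | true  = refl
        ... | false = refl

    E-N̂-ŝ : ∀ {u} → T u ≡ true → E N̂ (ŝ u) ≡ RU.E N u
    E-N̂-ŝ {u} Tu = trans (cong (E N̂) (sym (relabel-∈ {T} Tu))) (Relabel.E-image T N u)

    E-N̂-t̂ : ∀ {u} → T u ≡ false → E N̂ (t̂ u) ≡ RU.E N u
    E-N̂-t̂ {u} Tu = trans (cong (E N̂) (sym (relabel-∉ {T} Tu))) (Relabel.E-image T N u)

    disjoint : ∀ a → E M̂ a ≡ true → E N̂ a ≡ false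
    disjoint a a∈M̂ with Lift.E-image⁻¹ M a a∈M̂
    ... | u , refl , u∈M = bool-cases (E N̂ (t̂ u)) contra (λ e → e)
      where
        contra : E N̂ (t̂ u) ≡ true → E N̂ (t̂ u) ≡ false
        contra h with Relabel.E-image⁻¹ T N (t̂ u) h
        ... | v , ev , v∈N with T v in Tv | ev
        ...   | false | refl = ⊥-elim (true≢false (trans (cong (_∧ RU.E N v) u∈M) v∈N) Tv)

    isRankFunction : IsRankFunction (M⊕N′ M N)
    isRankFunction = ⊕-isRankFunction M̂-isRankFunction N̂-isRankFunction disjoint

    q̂∉E : ∀ u → E (M⊕N′ M N) (q̂ u) ≡ false
    q̂∉E u = trans (E-⊕ M̂ N̂ (q̂ u)) (cong₂ _∨_ q̂∉M̂ q̂∉N̂)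
      where
        q̂∉M̂ : E M̂ (q̂ u) ≡ false
        q̂∉M̂ = bool-cases (E M̂ (q̂ u)) (λ h → contra (Lift.E-image⁻¹ M (q̂ u) h)) (λ e → e)
          where
            contra : Σ U (λ v → t̂ v ≡ q̂ u × RU.E M v ≡ true) → E M̂ (q̂ u) ≡ false
            contra (_ , () , _)
        q̂∉N̂ : E N̂ (q̂ u) ≡ false
        q̂∉N̂ = bool-cases (E N̂ (q̂ u)) (λ h → contra (Relabel.E-image⁻¹ T N (q̂ u) h)) (λ e → e)
          where
            contra : Σ U (λ v → relabel T v ≡ q̂ u × RU.E N v ≡ true) → E N̂ (q̂ u) ≡ false
            contra (v , e , _) = ⊥-elim (relabel≢q̂ T v u e)

    t̂∈E : ∀ {t} → T t ≡ true → E (M⊕N′ M N) (t̂ t) ≡ true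
    t̂∈E {t} Tt = trans (E-⊕ M̂ N̂ (t̂ t)) (∨-introˡ _ (trans (Lift.E-image M t) (∧-elimˡ Tt)))

    ŝ∈E : ∀ {t} → T t ≡ true → E (M⊕N′ M N) (ŝ t) ≡ true
    ŝ∈E {t} Tt = trans (E-⊕ M̂ N̂ (ŝ t))
      (∨-introʳ (E M̂ (ŝ t)) (trans (E-N̂-ŝ Tt) (∧-elimʳ {RU.E M t} Tt)))

    rank-M⊕N′ : ∀ Z → rank (M⊕N′ M N) Z ≡ rank M (λ u → Z (t̂ u)) + rank N (relabel⁻¹ T Z)
    rank-M⊕N′ Z = cong₂ _+_ (RU.IsRankFunction.rank-cong rM _ _ onM) (RU.IsRankFunction.rank-cong rN _ _ onN)
      where
        onM : ∀ u → RU.E M u ≡ true → (Z (t̂ u) ∧ E M̂ (t̂ u)) ≡ Z (t̂ u)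
        onM u e = trans (cong (Z (t̂ u) ∧_) (trans (Lift.E-image M u) e)) (∧-identityʳ _)
        onN : ∀ u → RU.E N u ≡ true →
              (if T u then Z (ŝ u) ∧ E N̂ (ŝ u) else Z (t̂ u) ∧ E N̂ (t̂ u)) ≡ relabel⁻¹ T Z u
        onN u e with T u in Tu
        ... | true  = trans (cong (Z (ŝ u) ∧_) (trans (E-N̂-ŝ Tu) e)) (∧-identityʳ _)
        ... | false = trans (cong (Z (t̂ u) ∧_) (trans (E-N̂-t̂ Tu) e)) (∧-identityʳ _)

  AvoidsQ : Subset 𝕎 → Set
  AvoidsQ Y = ∀ u → Y (q̂ u) ≡ false

  module QExtensions (B : RawMatroid 𝕎) (isRankB : IsRankFunction B) (q̂∉E : ∀ u → E B (q̂ u) ≡ false) where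

    record IsQExtension (L : RawMatroid 𝕎) : Set where
      field
        isRank      : IsRankFunction L
        E-⊇         : ∀ a → E B a ≡ true → E L a ≡ true
        rank-agrees : ∀ Y → AvoidsQ Y → rank L Y ≡ rank B Y

    isQExtension-base : IsQExtension B
    isQExtension-base = record { isRank = isRankB ; E-⊇ = λ a e → e ; rank-agrees = λ Y _ → refl }

    isQExtension-step : ∀ {L} → IsQExtension L → ∀ t → IsQExtension (extendAt B L t)
    isQExtension-step {L} ext t = record
      { isRank      = principalExt-isRankFunction
      ; E-⊇         = λ a e → ∈E⇒∈E₊ (E-⊇ a e)
      ; rank-agrees = λ Y avoids → trans (rank₊-∉ (avoids t)) (rank-agrees Y avoids) }
      where
        open IsQExtension ext
        open PrincipalExtension isRank (flat B t) (q̂ t)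

    isQExtension-fold : ∀ {L} → IsQExtension L → ∀ ts → IsQExtension (foldl (extendAt B) L ts)
    isQExtension-fold ext []       = ext
    isQExtension-fold ext (t ∷ ts) = isQExtension-fold (isQExtension-step ext t) ts

    module _ {L : RawMatroid 𝕎} (ext : IsQExtension L) where
      open IsQExtension ext
      private
        module CB = Closure isRankB
        module CL = Closure isRank

      flat⊆cl-pair : ∀ t → flat B t ⊆ˢ cl _≟𝕎_ L (pair t)
      flat⊆cl-pair t a a∈flat = CL.spans⇒∈cl (E-⊇ a a∈E)
          (trans (rank-agrees _ pair∪a-avoids) (trans (CB.∈cl⇒spans a∈flat) (sym (rank-agrees _ (λ u → refl)))))
        where
          a∈E : E B a ≡ true
          a∈E = CB.∈cl⇒∈E a∈flat
          pair∪a-avoids : AvoidsQ (pair t ∪ˢ ⁅ a ⁆)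
          pair∪a-avoids u = ⁅⁆-other (λ q≡a → true≢false (subst (λ w → E B w ≡ true) (sym q≡a) a∈E) (q̂∉E u))

      flat⊆cl≡t̂∧ŝ∈cl : ∀ t → E B (t̂ t) ≡ true → E B (ŝ t) ≡ true → ∀ Z →
                       subsetᵇ _≟𝕎_ L (flat B t) (cl _≟𝕎_ L Z) ≡ (cl _≟𝕎_ L Z (t̂ t) ∧ cl _≟𝕎_ L Z (ŝ t))
      flat⊆cl≡t̂∧ŝ∈cl t t̂∈E ŝ∈E Z = ≡-from-⇔
        (λ h → cong₂ _∧_ (subsetᵇ-sound L (flat B t) (cl _≟𝕎_ L Z) h (t̂ t) (E-⊇ _ t̂∈E) t̂∈flat)
                         (subsetᵇ-sound L (flat B t) (cl _≟𝕎_ L Z) h (ŝ t) (E-⊇ _ ŝ∈E) ŝ∈flat))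
        (λ h → subsetᵇ-complete L (flat B t) (cl _≟𝕎_ L Z) (λ a _ a∈flat →
          CL.cl-pair-⊆ (∧-elimˡ h) (∧-elimʳ {cl _≟𝕎_ L Z (t̂ t)} h) a (flat⊆cl-pair t a a∈flat)))
        where
          t̂∈flat : flat B t (t̂ t) ≡ true
          t̂∈flat = CB.⊆cl t̂∈E (∨-introˡ _ (⁅⁆-self (t̂ t)))
          ŝ∈flat : flat B t (ŝ t) ≡ true
          ŝ∈flat = CB.⊆cl ŝ∈E (∨-introʳ (⁅ t̂ t ⁆ (ŝ t)) (⁅⁆-self (ŝ t)))

      module _ {t : U} (t̂∈E : E B (t̂ t) ≡ true) (ŝ∈E : E B (ŝ t) ≡ true) where
        open PrincipalExtension isRank (flat B t) (q̂ t)

        -- Once t̂ t ∈ Z, the flat X_t lies in cl Z exactly when ŝ t does,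
        -- so q̂ t raises the rank exactly as ŝ t would.
        rank-extendAt-as-ŝ : ∀ {Z} → Z (q̂ t) ≡ true → Z (t̂ t) ≡ true →
                              rank (extendAt B L t) Z ≡ rank L ((Z ∖q) ∪ˢ ⁅ ŝ t ⁆)
        rank-extendAt-as-ŝ {Z} q∈Z t∈Z = trans (rank₊-∈ q∈Z) (bool-cases (cl _≟𝕎_ L (Z ∖q) (ŝ t)) spanned unspanned)
          where
            t̂∈cl : cl _≟𝕎_ L (Z ∖q) (t̂ t) ≡ true
            t̂∈cl = CL.⊆cl (E-⊇ _ t̂∈E) (trans (∧-identityʳ _) t∈Z)
            spansX≡ŝ∈cl : spansX (Z ∖q) ≡ cl _≟𝕎_ L (Z ∖q) (ŝ t)
            spansX≡ŝ∈cl = trans (flat⊆cl≡t̂∧ŝ∈cl t t̂∈E ŝ∈E (Z ∖q)) (cong (_∧ cl _≟𝕎_ L (Z ∖q) (ŝ t)) t̂∈cl)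
            spanned : cl _≟𝕎_ L (Z ∖q) (ŝ t) ≡ true → ρ (Z ∖q) ≡ rank L ((Z ∖q) ∪ˢ ⁅ ŝ t ⁆)
            spanned c = trans (cong (rank L (Z ∖q) +_) (δ-spans (trans spansX≡ŝ∈cl c)))
                              (trans (+-identityʳ _) (sym (CL.∈cl⇒spans c)))
            unspanned : cl _≟𝕎_ L (Z ∖q) (ŝ t) ≡ false → ρ (Z ∖q) ≡ rank L ((Z ∖q) ∪ˢ ⁅ ŝ t ⁆)
            unspanned c = trans (cong (rank L (Z ∖q) +_) (δ-¬spans (trans spansX≡ŝ∈cl c)))
                                (trans (+-comm _ 1) (sym (CL.∉cl⇒rank-suc (E-⊇ _ ŝ∈E) c)))

  module Contraction {M N : RawMatroid U} (mM : IsMatroid _≟_ M) (mN : IsMatroid _≟_ N)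
                     (P : Subset U) (P⊆T : P ⊆ˢ common _≟_ M N) where
    M/P N/P : RawMatroid U
    M/P = contract _≟_ M P
    N/P = contract _≟_ N P

    rM : RU.IsRankFunction M
    rM = RU.isMatroid⇒isRankFunction mM
    rN : RU.IsRankFunction N
    rN = RU.isMatroid⇒isRankFunction mN
    rM/P : RU.IsRankFunction M/P
    rM/P = RU.contract-isRankFunction P rM
    rN/P : RU.IsRankFunction N/P
    rN/P = RU.contract-isRankFunction P rN

    T T∖P : Subset U
    T = common _≟_ M N
    T∖P = common _≟_ M/P N/P

    B B/P : RawMatroid 𝕎
    B = M⊕N′ M N
    B/P = M⊕N′ M/P N/P

    module D = DirectSum rM rN
    module D/P = DirectSum rM/P rN/P
    module X = QExtensions B D.isRankFunction D.q̂∉E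
    module X/P = QExtensions B/P D/P.isRankFunction D/P.q̂∉E

    T∖P-≡ : ∀ u → T∖P u ≡ T u ∧ not (P u)
    T∖P-≡ u rewrite RU.E-contract M P u | RU.E-contract N P u with P u
    ... | true  = sym (∧-zeroʳ _)
    ... | false = sym (∧-identityʳ _)

    T∖P-∉P : ∀ {u} → P u ≡ false → T∖P u ≡ T u
    T∖P-∉P {u} Pu = trans (T∖P-≡ u) (trans (cong (λ z → T u ∧ not z) Pu) (∧-identityʳ _))

    outsideP : Subset 𝕎
    outsideP (inj₁ u)        = not (P u)
    outsideP (inj₂ (inj₁ u)) = not (P u)
    outsideP (inj₂ (inj₂ u)) = not (P u)

    -- The points indexed by P that are contracted while the points of T in ts are
    -- still to be processed: every t̂ p, and ŝ p or q̂ p as p is in ts or not.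
    contracted : List U → Subset 𝕎
    contracted ts (inj₁ u)        = P u
    contracted ts (inj₂ (inj₁ u)) = P u ∧ RU.elemᵇ ts u
    contracted ts (inj₂ (inj₂ u)) = P u ∧ not (RU.elemᵇ ts u)

    Simulates : RawMatroid 𝕎 → RawMatroid 𝕎 → List U → Set
    Simulates L L′ ts = ∀ Y → Y ⊆ˢ outsideP → rank L (Y ∪ˢ contracted ts) ∸ rank L (contracted ts) ≡ rank L′ Y

    cl-contracted : ∀ {L L′ ts} → IsRankFunction L → Simulates L L′ ts →
                    ∀ {Z} → Z ⊆ˢ outsideP → ∀ {a} → outsideP a ≡ true → E L a ≡ E L′ a →
                    cl _≟𝕎_ L (Z ∪ˢ contracted ts) a ≡ cl _≟𝕎_ L′ Z a
    cl-contracted {L} {L′} {ts} isRank sim {Z} Z⊆ {a} a∈ Ea = cong₂ _∧_ Ea (begin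
      (r ((Z ∪ˢ C) ∪ˢ ⁅ a ⁆) ≡ᵇ r (Z ∪ˢ C))
        ≡⟨ cong (_≡ᵇ r (Z ∪ˢ C)) (rank-≗ (λ b → ∨-swapʳ (Z b) (C b) (⁅ a ⁆ b))) ⟩
      (r (Za ∪ˢ C) ≡ᵇ r (Z ∪ˢ C))
        ≡⟨ ∸-≡ᵇ-cancelʳ (rank-∪-mono C Za) (rank-∪-mono C Z) ⟨
      (r (Za ∪ˢ C) ∸ r C ≡ᵇ r (Z ∪ˢ C) ∸ r C)
        ≡⟨ cong₂ _≡ᵇ_ (sim Za Za⊆) (sim Z Z⊆) ⟩
      (rank L′ Za ≡ᵇ rank L′ Z)
        ∎)
      where
        open ≡-Reasoning
        open Closure isRank
        C : Subset 𝕎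
        C = contracted ts
        r : Subset 𝕎 → ℕ
        r = rank L
        Za : Subset 𝕎
        Za = Z ∪ˢ ⁅ a ⁆
        Za⊆ : Za ⊆ˢ outsideP
        Za⊆ b h with Z b in zb
        ... | true  = Z⊆ b zb
        ... | false rewrite ⁅⁆-sound h = a∈

    contracted-∷-∉P : ∀ {t} ts → P t ≡ false → ∀ w → contracted (t ∷ ts) w ≡ contracted ts w
    contracted-∷-∉P ts Pt (inj₁ u) = refl
    contracted-∷-∉P {t} ts Pt (inj₂ (inj₁ u)) with u ≟ t
    ... | yes refl rewrite Pt = refl
    ... | no _ = refl
    contracted-∷-∉P {t} ts Pt (inj₂ (inj₂ u)) with u ≟ t
    ... | yes refl rewrite Pt = refl
    ... | no _ = refl

    simulates-∷-∉P : ∀ {L L′ t ts} → IsRankFunction L → P t ≡ false →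
                     Simulates L L′ (t ∷ ts) → Simulates L L′ ts
    simulates-∷-∉P {t = t} {ts = ts} isRank Pt sim Y Y⊆ =
      trans (cong₂ _∸_ (rank-≗ (λ w → cong (Y w ∨_) (sym (C≗ w)))) (rank-≗ (λ w → sym (C≗ w)))) (sim Y Y⊆)
      where
        open Closure isRank
        C≗ : ∀ w → contracted (t ∷ ts) w ≡ contracted ts w
        C≗ = contracted-∷-∉P ts Pt

    simulate-step-∉P : ∀ {t ts L L′} → X.IsQExtension L → X/P.IsQExtension L′ → T t ≡ true → P t ≡ false →
                       Simulates L L′ (t ∷ ts) → Simulates (extendAt B L t) (extendAt B/P L′ t) ts
    simulate-step-∉P {t} {ts} {L} {L′} ext ext′ Tt Pt sim∷ Y Y⊆ = bool-cases (Y (q̂ t)) q∈Y q∉Y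
      where
        open Closure (X.IsQExtension.isRank ext)
        module E₁ = PrincipalExtension (X.IsQExtension.isRank ext) (flat B t) (q̂ t)
        module E₂ = PrincipalExtension (X/P.IsQExtension.isRank ext′) (flat B/P t) (q̂ t)
        open E₁ using (_∖q)
        C : Subset 𝕎
        C = contracted ts
        sim : Simulates L L′ ts
        sim = simulates-∷-∉P {L′ = L′} {t = t} (X.IsQExtension.isRank ext) Pt sim∷
        q∉C : C (q̂ t) ≡ false
        q∉C rewrite Pt = refl
        t∈T∖P : T∖P t ≡ true
        t∈T∖P = trans (T∖P-∉P Pt) Tt
        Y∖q⊆ : (Y ∖q) ⊆ˢ outsideP
        Y∖q⊆ w h = Y⊆ w (∧-elimˡ h)

        cl-corresponds : ∀ {a} → outsideP a ≡ true → E B a ≡ true → E B/P a ≡ true →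
                         cl _≟𝕎_ L ((Y ∖q) ∪ˢ C) a ≡ cl _≟𝕎_ L′ (Y ∖q) a
        cl-corresponds a∈ a∈B a∈B/P = cl-contracted {L′ = L′} (X.IsQExtension.isRank ext) sim Y∖q⊆ a∈
          (trans (X.IsQExtension.E-⊇ ext _ a∈B) (sym (X/P.IsQExtension.E-⊇ ext′ _ a∈B/P)))

        spansX-corresponds : E₁.spansX ((Y ∖q) ∪ˢ C) ≡ E₂.spansX (Y ∖q)
        spansX-corresponds = begin
          E₁.spansX ((Y ∖q) ∪ˢ C)
            ≡⟨ X.flat⊆cl≡t̂∧ŝ∈cl ext t (D.t̂∈E Tt) (D.ŝ∈E Tt) _ ⟩
          cl _≟𝕎_ L ((Y ∖q) ∪ˢ C) (t̂ t) ∧ cl _≟𝕎_ L ((Y ∖q) ∪ˢ C) (ŝ t)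
            ≡⟨ cong₂ _∧_ (cl-corresponds (cong not Pt) (D.t̂∈E Tt) (D/P.t̂∈E t∈T∖P))
                         (cl-corresponds (cong not Pt) (D.ŝ∈E Tt) (D/P.ŝ∈E t∈T∖P)) ⟩
          cl _≟𝕎_ L′ (Y ∖q) (t̂ t) ∧ cl _≟𝕎_ L′ (Y ∖q) (ŝ t)
            ≡⟨ X/P.flat⊆cl≡t̂∧ŝ∈cl ext′ t (D/P.t̂∈E t∈T∖P) (D/P.ŝ∈E t∈T∖P) _ ⟨
          E₂.spansX (Y ∖q)
            ∎
          where open ≡-Reasoning

        q∉Y : Y (q̂ t) ≡ false →
              rank (extendAt B L t) (Y ∪ˢ C) ∸ rank (extendAt B L t) C ≡ rank (extendAt B/P L′ t) Y
        q∉Y e = trans (cong₂ _∸_ (E₁.rank₊-∉ (cong₂ _∨_ e q∉C)) (E₁.rank₊-∉ q∉C))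
                      (trans (sim Y Y⊆) (sym (E₂.rank₊-∉ e)))

        q∈Y : Y (q̂ t) ≡ true →
              rank (extendAt B L t) (Y ∪ˢ C) ∸ rank (extendAt B L t) C ≡ rank (extendAt B/P L′ t) Y
        q∈Y e = begin
          rank (extendAt B L t) (Y ∪ˢ C) ∸ rank (extendAt B L t) C
            ≡⟨ cong₂ _∸_ (trans (E₁.rank₊-∈ (∨-introˡ _ e)) (E₁.ρ-≗ (E₁.∪-∖q Y q∉C))) (E₁.rank₊-∉ q∉C) ⟩
          rank L ((Y ∖q) ∪ˢ C) + E₁.δ ((Y ∖q) ∪ˢ C) ∸ rank L C
            ≡⟨ +-∸-comm (E₁.δ ((Y ∖q) ∪ˢ C)) (rank-∪-mono C (Y ∖q)) ⟩
          rank L ((Y ∖q) ∪ˢ C) ∸ rank L C + E₁.δ ((Y ∖q) ∪ˢ C)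
            ≡⟨ cong₂ _+_ (sim (Y ∖q) Y∖q⊆) (cong (λ b → if b then 0 else 1) spansX-corresponds) ⟩
          rank L′ (Y ∖q) + E₂.δ (Y ∖q)
            ≡⟨ E₂.rank₊-∈ e ⟨
          rank (extendAt B/P L′ t) Y
            ∎
          where open ≡-Reasoning

    -- For p ∈ P the point t̂ p is already contracted, so contracting q̂ p in the
    -- extension at p has the effect of contracting ŝ p (rank-extendAt-as-ŝ).
    simulate-step-∈P : ∀ {t ts L L′} → X.IsQExtension L → P t ≡ true → RU.elemᵇ ts t ≡ false →
                       Simulates L L′ (t ∷ ts) → Simulates (extendAt B L t) L′ ts
    simulate-step-∈P {t} {ts} {L} {L′} ext Pt t∉ts sim Y Y⊆ =
      trans (cong₂ _∸_ (trans (as-ŝ (∨-introʳ (Y (q̂ t)) q̂∈C) (∨-introʳ (Y (t̂ t)) Pt)) (rank-≗ (ŝ-for-q̂ Y Y⊆)))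
                       (trans (as-ŝ q̂∈C Pt) (rank-≗ (ŝ-for-q̂ (λ _ → false) (λ _ ())))))
            (sim Y Y⊆)
      where
        open Closure (X.IsQExtension.isRank ext)
        open PrincipalExtension (X.IsQExtension.isRank ext) (flat B t) (q̂ t) using (_∖q)
        Tt : T t ≡ true
        Tt = P⊆T t Pt
        as-ŝ : ∀ {Z} → Z (q̂ t) ≡ true → Z (t̂ t) ≡ true →
               rank (extendAt B L t) Z ≡ rank L ((Z ∖q) ∪ˢ ⁅ ŝ t ⁆)
        as-ŝ = X.rank-extendAt-as-ŝ ext (D.t̂∈E Tt) (D.ŝ∈E Tt)
        C : Subset 𝕎
        C = contracted ts
        q̂∈C : C (q̂ t) ≡ true
        q̂∈C rewrite Pt | t∉ts = refl

        ŝ-for-q̂ : ∀ Z → Z ⊆ˢ outsideP → ∀ w → (((Z ∪ˢ C) ∖q) ∪ˢ ⁅ ŝ t ⁆) w ≡ (Z ∪ˢ contracted (t ∷ ts)) w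
        ŝ-for-q̂ Z Z⊆ (inj₁ u) = trans (∨-identityʳ _) (∧-identityʳ _)
        ŝ-for-q̂ Z Z⊆ (inj₂ (inj₁ u)) =
          trans (cong (λ e → ((Z (ŝ u) ∨ (P u ∧ RU.elemᵇ ts u)) ∧ true) ∨ e) (≟-ŝ u t))
                (at-ŝ (Z (ŝ u)) (RU.elemᵇ ts u) (isYes (u ≟ t)) u≡t⇒Pu)
          where
            u≡t⇒Pu : isYes (u ≟ t) ≡ true → P u ≡ true
            u≡t⇒Pu h rewrite RU.⁅⁆-sound h = Pt
            at-ŝ : ∀ z m e → (e ≡ true → P u ≡ true) →
                   ((z ∨ (P u ∧ m)) ∧ true) ∨ e ≡ z ∨ (P u ∧ (e ∨ m))
            at-ŝ z m true  h rewrite h refl = trans (∨-zeroʳ _) (sym (∨-zeroʳ z))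
            at-ŝ z m false h = trans (∨-identityʳ _) (∧-identityʳ _)
        ŝ-for-q̂ Z Z⊆ (inj₂ (inj₂ u)) =
          trans (cong (λ e → ((Z (q̂ u) ∨ (P u ∧ not (RU.elemᵇ ts u))) ∧ not e) ∨ false) (≟-q̂ u t))
                (at-q̂ (Z (q̂ u)) (RU.elemᵇ ts u) (isYes (u ≟ t)) u≡t⇒q̂u∉Z)
          where
            u≡t⇒q̂u∉Z : isYes (u ≟ t) ≡ true → Z (q̂ u) ≡ false
            u≡t⇒q̂u∉Z h rewrite RU.⁅⁆-sound h =
              bool-cases (Z (q̂ t)) (λ e → ⊥-elim (true≢false (Z⊆ _ e) (cong not Pt))) (λ e → e)
            at-q̂ : ∀ z m e → (e ≡ true → z ≡ false) →
                   ((z ∨ (P u ∧ not m)) ∧ not e) ∨ false ≡ z ∨ (P u ∧ not (e ∨ m))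
            at-q̂ z m true  h rewrite h refl = trans (∨-identityʳ _) (trans (∧-zeroʳ _) (sym (∧-zeroʳ (P u))))
            at-q̂ z m false h = trans (∨-identityʳ _) (∧-identityʳ _)

    notP : U → Bool
    notP a = not (P a)

    simulate-fold : ∀ ts {L L′} → Unique ts → All (λ t → T t ≡ true) ts →
                    X.IsQExtension L → X/P.IsQExtension L′ → Simulates L L′ ts →
                    Simulates (foldl (extendAt B) L ts) (foldl (extendAt B/P) L′ (filterᵇ notP ts)) []
    simulate-fold []       _             _          _   _    sim = sim
    simulate-fold (t ∷ ts) {L′ = L′} (t∉ts ∷ uts) (Tt ∷ Tts) ext ext′ sim with P t in Pt
    ... | true  = simulate-fold ts uts Tts (X.isQExtension-step ext t) ext′
                    (simulate-step-∈P {L′ = L′} ext Pt (RU.elemᵇ-∉ t ts t∉ts) sim)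
    ... | false = simulate-fold ts uts Tts (X.isQExtension-step ext t) (X/P.isQExtension-step ext′ t)
                    (simulate-step-∉P ext ext′ Tt Pt sim)

    Ts : List U
    Ts = filterᵇ T (elems M)

    T⊆Ts : ∀ {u} → T u ≡ true → RU.elemᵇ Ts u ≡ true
    T⊆Ts {u} Tu = trans (RU.elemᵇ-filter T (elems M) u) (cong₂ _∧_ Tu (∧-elimˡ Tu))

    relabel⁻¹-∪ : ∀ {S} Y Z u → relabel⁻¹ S (Y ∪ˢ Z) u ≡ relabel⁻¹ S Y u ∨ relabel⁻¹ S Z u
    relabel⁻¹-∪ {S} Y Z u with S u
    ... | true  = refl
    ... | false = refl

    relabel⁻¹-contracted : ∀ u → relabel⁻¹ T (contracted Ts) u ≡ P u
    relabel⁻¹-contracted u with T u in Tu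
    ... | false = refl
    ... | true with P u
    ...   | true  = T⊆Ts Tu
    ...   | false = refl

    relabel⁻¹-T∖P : ∀ Y {u} → P u ≡ false → relabel⁻¹ T Y u ≡ relabel⁻¹ T∖P Y u
    relabel⁻¹-T∖P Y {u} Pu = cong (λ c → if c then Y (ŝ u) else Y (t̂ u)) (sym (T∖P-∉P Pu))

    simulate-base : Simulates B B/P Ts
    simulate-base Y _ = begin
      rank B (Y ∪ˢ C) ∸ rank B C
        ≡⟨ cong₂ _∸_ (D.rank-M⊕N′ (Y ∪ˢ C)) (D.rank-M⊕N′ C) ⟩
      (rank M (λ u → Y (t̂ u) ∨ P u) + rank N (relabel⁻¹ T (Y ∪ˢ C))) ∸ (rank M P + rank N (relabel⁻¹ T C))
        ≡⟨ cong₂ (λ x y → (rank M (λ u → Y (t̂ u) ∨ P u) + x) ∸ (rank M P + y))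
                 (RU.Closure.rank-≗ rN on-N) (RU.Closure.rank-≗ rN relabel⁻¹-contracted) ⟩
      (rank M (λ u → Y (t̂ u) ∨ P u) + rank N (relabel⁻¹ T∖P Y ∪ˢ P)) ∸ (rank M P + rank N P)
        ≡⟨ [m+n]∸[o+p]≡[m∸o]+[n∸p] (RU.Closure.rank-∪-mono rM P _) (RU.Closure.rank-∪-mono rN P _) ⟩
      (rank M (λ u → Y (t̂ u) ∨ P u) ∸ rank M P) + (rank N (relabel⁻¹ T∖P Y ∪ˢ P) ∸ rank N P)
        ≡⟨ D/P.rank-M⊕N′ Y ⟨
      rank B/P Y
        ∎
      where
        open ≡-Reasoning
        C : Subset 𝕎
        C = contracted Ts
        on-N : ∀ u → relabel⁻¹ T (Y ∪ˢ C) u ≡ (relabel⁻¹ T∖P Y ∪ˢ P) u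
        on-N u = trans (relabel⁻¹-∪ {T} Y C u)
                       (trans (cong (relabel⁻¹ T Y u ∨_) (relabel⁻¹-contracted u)) (agree (P u) refl))
          where
            agree : ∀ p → P u ≡ p → relabel⁻¹ T Y u ∨ p ≡ relabel⁻¹ T∖P Y u ∨ p
            agree true  _  = trans (∨-zeroʳ _) (sym (∨-zeroʳ _))
            agree false Pu = cong (_∨ false) (relabel⁻¹-T∖P Y Pu)

    filter-T∖P : ∀ xs → filterᵇ T∖P (filterᵇ notP xs) ≡ filterᵇ notP (filterᵇ T xs)
    filter-T∖P []       = refl
    filter-T∖P (x ∷ xs) with T x in Tx
    ... | true with P x in Px
    ...   | true  = filter-T∖P xs
    ...   | false rewrite T∖P-≡ x | Px | Tx = cong (x ∷_) (filter-T∖P xs)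
    filter-T∖P (x ∷ xs) | false with P x in Px
    ...   | true  = filter-T∖P xs
    ...   | false rewrite T∖P-≡ x | Px | Tx = filter-T∖P xs

    filterᵇ-all : ∀ (f : U → Bool) xs → All (λ x → f x ≡ true) (filterᵇ f xs)
    filterᵇ-all f []       = []
    filterᵇ-all f (x ∷ xs) with f x in e
    ... | true  = e ∷ filterᵇ-all f xs
    ... | false = filterᵇ-all f xs

    simulate-H : Simulates (H M N) (H M/P N/P) []
    simulate-H = subst (λ ts → Simulates (H M N) (foldl (extendAt B/P) B/P ts) []) (sym (filter-T∖P (elems M)))
      (simulate-fold Ts (Unique.filter⁺ (λ x → T? (T x)) (IsMatroid.unique mM)) (filterᵇ-all T (elems M))
                     X.isQExtension-base X/P.isQExtension-base simulate-base)

    rH : IsRankFunction (H M N)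
    rH = X.IsQExtension.isRank (X.isQExtension-fold X.isQExtension-base Ts)

    rH/P : IsRankFunction (H M/P N/P)
    rH/P = X/P.IsQExtension.isRank
             (X/P.isQExtension-fold X/P.isQExtension-base (filterᵇ T∖P (elems M/P)))

    Q Q/P : Subset 𝕎
    Q = Qset _≟_ T
    Q/P = Qset _≟_ T∖P

    Q≗Q/P∪P : ∀ u → T u ≡ T∖P u ∨ (P u ∧ true)
    Q≗Q/P∪P u = bool-cases (P u)
      (λ Pu → trans (P⊆T u Pu) (sym (∨-introʳ (T∖P u) (trans (∧-identityʳ _) Pu))))
      (λ Pu → sym (trans (cong₂ _∨_ (T∖P-∉P Pu) (trans (∧-identityʳ _) Pu)) (∨-identityʳ _)))

    Q/P⊆outsideP : Q/P ⊆ˢ outsideP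
    Q/P⊆outsideP (inj₂ (inj₂ u)) h rewrite T∖P-≡ u = ∧-elimʳ {T u} h

    rank-contract-bond : ∀ X → X ⊆ˢ RU.E (contract _≟_ (bond _≟_ M N) P) →
                         rank (contract _≟_ (bond _≟_ M N) P) X ≡ rank (bond _≟_ M/P N/P) X
    rank-contract-bond X X⊆E = begin
      rank (bond _≟_ M N) (X ∪ˢ P) ∸ rank (bond _≟_ M N) P
        ≡⟨ cong₂ _∸_ (rank-bond M N (X ∪ˢ P) rH) (rank-bond M N P rH) ⟩
      (r (embed (X ∪ˢ P) ∪ˢ Q) ∸ r Q) ∸ (r (embed P ∪ˢ Q) ∸ r Q)
        ≡⟨ [m∸o]∸[n∸o]≡m∸n (rank-∪-mono Q (embed P)) ⟩
      r (embed (X ∪ˢ P) ∪ˢ Q) ∸ r (embed P ∪ˢ Q)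
        ≡⟨ cong₂ _∸_ (rank-≗ embed-X∪P) (rank-≗ embed-P) ⟩
      r (Y₁ ∪ˢ C) ∸ r (Q/P ∪ˢ C)
        ≡⟨ [m∸o]∸[n∸o]≡m∸n (rank-∪-mono C Q/P) ⟨
      (r (Y₁ ∪ˢ C) ∸ r C) ∸ (r (Q/P ∪ˢ C) ∸ r C)
        ≡⟨ cong₂ _∸_ (simulate-H Y₁ Y₁⊆outsideP) (simulate-H Q/P Q/P⊆outsideP) ⟩
      rank (H M/P N/P) Y₁ ∸ rank (H M/P N/P) Q/P
        ≡⟨ rank-bond M/P N/P X rH/P ⟨
      rank (bond _≟_ M/P N/P) X
        ∎
      where
        open ≡-Reasoning
        open Closure rH
        r : Subset 𝕎 → ℕ
        r = rank (H M N)
        C : Subset 𝕎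
        C = contracted []
        Y₁ : Subset 𝕎
        Y₁ = embed X ∪ˢ Q/P

        Y₁⊆outsideP : Y₁ ⊆ˢ outsideP
        Y₁⊆outsideP (inj₁ u)        h =
          ∧-elimˡ (trans (sym (RU.E-contract (bond _≟_ M N) P u)) (X⊆E u (trans (sym (∨-identityʳ (X u))) h)))
        Y₁⊆outsideP (inj₂ (inj₂ u)) h = Q/P⊆outsideP (q̂ u) h

        embed-X∪P : ∀ w → (embed (X ∪ˢ P) ∪ˢ Q) w ≡ (Y₁ ∪ˢ C) w
        embed-X∪P (inj₁ u)        = trans (∨-identityʳ _) (cong (_∨ P u) (sym (∨-identityʳ (X u))))
        embed-X∪P (inj₂ (inj₁ u)) = sym (∧-zeroʳ (P u))
        embed-X∪P (inj₂ (inj₂ u)) = Q≗Q/P∪P u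

        embed-P : ∀ w → (embed P ∪ˢ Q) w ≡ (Q/P ∪ˢ C) w
        embed-P (inj₁ u)        = ∨-identityʳ _
        embed-P (inj₂ (inj₁ u)) = sym (∧-zeroʳ (P u))
        embed-P (inj₂ (inj₂ u)) = Q≗Q/P∪P u

    E-contract-bond : ∀ a → RU.E (contract _≟_ (bond _≟_ M N) P) a ≡ RU.E (bond _≟_ M/P N/P) a
    E-contract-bond a = begin
      RU.E (contract _≟_ (bond _≟_ M N) P) a   ≡⟨ RU.E-contract (bond _≟_ M N) P a ⟩
      not (P a) ∧ RU.E (bond _≟_ M N) a        ≡⟨ cong (not (P a) ∧_) (E-bond M N a) ⟩
      not (P a) ∧ (RU.E M a ∨ RU.E N a)        ≡⟨ ∧-distribˡ-∨ (not (P a)) (RU.E M a) (RU.E N a) ⟩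
      not (P a) ∧ RU.E M a ∨ not (P a) ∧ RU.E N a ≡⟨ cong₂ _∨_ (RU.E-contract M P a) (RU.E-contract N P a) ⟨
      RU.E M/P a ∨ RU.E N/P a                  ≡⟨ E-bond M/P N/P a ⟨
      RU.E (bond _≟_ M/P N/P) a                ∎
      where open ≡-Reasoning

lemma4p7 : {U : Set} (_≟_ : DecidableEquality U) (M N : RawMatroid U) →
    IsMatroid _≟_ M → IsMatroid _≟_ N →
    Σ U (λ t → common _≟_ M N t ≡ true) →
    (P : Subset U) →
    Σ U (λ p → P p ≡ true) →
    P ⊆ˢ common _≟_ M N →
    Σ U (λ t → common _≟_ M N t ≡ true × P t ≡ false) →
    _≈ᴹ_ _≟_ (contract _≟_ (bond _≟_ M N) P)
             (bond _≟_ (contract _≟_ M P) (contract _≟_ N P))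
lemma4p7 _≟_ M N mM mN _ P _ P⊆T _ =
  E-contract-bond , rank-contract-bond
  where open Bonding.Contraction _≟_ mM mN P P⊆T
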